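{- Let $n,p,q$ be positive integers with $n>q$, and let $\pi_{\mathrm{RRG}}$ be the stationary distribution of the restricted random growth model on $\chi^{p,q}$ (with parameter $n$). Then for all $\lambda,\mu\in\chi^{p,q}$, $$\frac{\pi_{\mathrm{RRG}}(\lambda)}{\pi_{\mathrm{RRG}}(\mu)}=\frac{|S_n(\lambda)|}{|S_n(\mu)|}\,u^{|\lambda|-|\mu|}.$$
   Context: Partitions are written as $n$-tuples $(\lambda_1\ge\cdots\ge\lambda_n\ge0)$; $|\lambda|=\sum\lambda_i$, $m_i(\lambda)$ is the number of parts equal to $i$, $\ell(\lambda)$ the number of positive parts; $S_n(\lambda)$ is the set of distinct rearrangements of $(\lambda_1,\dots,\lambda_n)$. $\chi^{p,q}=\{\lambda:\lambda_1\le p,\ \ell(\lambda)=q\}$. Restricted random growth model (parameter $u\in[0,1]$) on $\chi^{p,q}$ with transition probabilities $d^{(n)}_{\nu,\lambda}$ from $\nu$ to $\lambda$: $\frac{m_i(\nu)u}{3n}$ if $\lambda$ is obtained from $\nu$ by changing one part equal to $i$ into $i+1$; $\frac{m_i(\nu)}{3n}$ if $\lambda$ is obtained from $\nu$ by changing one part equal to $i$ into $i-1$; $0$ for other $\lambda\ne\nu$; $d^{(n)}_{\nu,\nu}=1-\sum_{\lambda\ne\nu}d^{(n)}_{\nu,\lambda}$.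
   Formalization: The parameter u is a rational number in [0,1], and the stationary distribution $\pi_{\mathrm{RRG}}$ takes rational values. -}

module Defs where

open import Data.Nat as ℕ using (ℕ; zero; suc; _≥_; _∸_)
open import Data.Nat.Properties using (_≟_; _≥?_; _≤?_)
open import Data.Fin using (Fin)
open import Data.Vec as V using (Vec; []; _∷_; toList; lookup; _[_]≔_)
open import Data.List as L using (List; []; _∷_; filter; length; map; concatMap; upTo; allFin; _++_; foldr)
open import Data.List.Relation.Unary.All using (All; all?)
open import Data.List.Relation.Unary.Any using (Any; any?)
open import Data.List.Relation.Unary.Linked using (Linked; linked?)
open import Data.Integer using (+_)
import Data.Rational
open import Data.Rational using (ℚ; 0ℚ; 1ℚ; _+_; _*_; _-_; _/_)
open import Data.Product using (_×_)
open import Relation.Binary.PropositionalEquality using (_≡_)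
open import Relation.Nullary using (Dec; yes; no; _×-dec_; ¬?)
import Data.Vec.Properties as VP

-- Partitions as n-tuples of naturals (Vec ℕ n)

mult : ∀ {n} → ℕ → Vec ℕ n → ℕ
mult i la = length (filter (i ≟_) (toList la))

size : ∀ {n} → Vec ℕ n → ℕ
size la = foldr ℕ._+_ 0 (toList la)

len : ∀ {n} → Vec ℕ n → ℕ
len la = length (filter (_≥? 1) (toList la))

NonIncreasing : ∀ {n} → Vec ℕ n → Set
NonIncreasing la = Linked _≥_ (toList la)

-- χ^{p,q} = { λ : λ_1 ≤ p , ℓ(λ) = q }  (λ a partition, i.e. nonincreasing)
-- (for a nonincreasing tuple, λ_1 ≤ p is the same as all parts ≤ p)
Chi : (n p q : ℕ) → Vec ℕ n → Set
Chi n p q la = NonIncreasing la × All (ℕ._≤ p) (toList la) × len la ≡ q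

chi? : (n p q : ℕ) → (la : Vec ℕ n) → Dec (Chi n p q la)
chi? n p q la = linked? _≥?_ (toList la) ×-dec (all? (ℕ._≤? p) (toList la) ×-dec (len la ≟ q))

tuples : (n p : ℕ) → List (Vec ℕ n)
tuples zero    p = [] ∷ []
tuples (suc n) p = concatMap (λ x → map (x ∷_) (tuples n p)) (upTo (suc p))

chiList : (n p q : ℕ) → List (Vec ℕ n)
chiList n p q = filter (chi? n p q) (tuples n p)

SameMultiset : List ℕ → List ℕ → Set
SameMultiset xs ys =
  All (λ j → length (filter (j ≟_) xs) ≡ length (filter (j ≟_) ys)) (xs ++ ys)

sameMultiset? : (xs ys : List ℕ) → Dec (SameMultiset xs ys)
sameMultiset? xs ys =
  all? (λ j → length (filter (j ≟_) xs) ≟ length (filter (j ≟_) ys)) (xs ++ ys)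

-- S_n(λ): the set of distinct rearrangements of (λ_1,…,λ_n)
-- (every rearrangement has entries ≤ |λ|, so it is listed in tuples n |λ|,
--  without repetition)
rearrangements : ∀ {n} → Vec ℕ n → List (Vec ℕ n)
rearrangements {n} la =
  filter (λ μ → sameMultiset? (toList μ) (toList la)) (tuples n (size la))

numRearr : ∀ {n} → Vec ℕ n → ℕ
numRearr la = length (rearrangements la)

ℕtoℚ : ℕ → ℚ
ℕtoℚ k = (+ k) / 1

_^ℚ_ : ℚ → ℕ → ℚ
u ^ℚ zero  = 1ℚ
u ^ℚ suc k = u * (u ^ℚ k)

-- 1/(3n)  (n = 0 never occurs in the theorem, value irrelevant there)
inv3n : ℕ → ℚ
inv3n zero    = 0ℚ
inv3n (suc k) = (+ 1) / (3 ℕ.* suc k)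

𝟙 : ∀ {P : Set} → Dec P → ℚ
𝟙 (yes _) = 1ℚ
𝟙 (no _)  = 0ℚ

Σℚ : ∀ {A : Set} → List A → (A → ℚ) → ℚ
Σℚ xs f = foldr (λ x acc → f x + acc) 0ℚ xs

-- λ is obtained from ν by changing one part equal to i into i+1
-- (λ being a partition, i.e. the nonincreasing rearrangement)
Up : ∀ {n} → ℕ → Vec ℕ n → Vec ℕ n → Set
Up {n} i ν la =
  Any (λ k → (lookup ν k ≡ i) × SameMultiset (toList la) (toList (ν [ k ]≔ suc i))) (allFin n)

up? : ∀ {n} → (i : ℕ) → (ν la : Vec ℕ n) → Dec (Up i ν la)
up? {n} i ν la =
  any? (λ k → (lookup ν k ≟ i) ×-dec sameMultiset? (toList la) (toList (ν [ k ]≔ suc i))) (allFin n)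

Down : ∀ {n} → ℕ → Vec ℕ n → Vec ℕ n → Set
Down {n} i ν la =
  Any (λ k → (lookup ν k ≡ i) × (i ≥ 1) × SameMultiset (toList la) (toList (ν [ k ]≔ (i ∸ 1)))) (allFin n)

down? : ∀ {n} → (i : ℕ) → (ν la : Vec ℕ n) → Dec (Down i ν la)
down? {n} i ν la =
  any? (λ k → (lookup ν k ≟ i) ×-dec ((i ≥? 1) ×-dec sameMultiset? (toList la) (toList (ν [ k ]≔ (i ∸ 1))))) (allFin n)

-- off-diagonal transition probability (for λ ≠ ν); parts of ν lie in {0,…,p}
offDiag : (n p : ℕ) → (u : ℚ) → Vec ℕ n → Vec ℕ n → ℚ
offDiag n p u ν la =
  Σℚ (upTo (suc p)) (λ i →
       𝟙 (up? i ν la)   * (ℕtoℚ (mult i ν) * u * inv3n n)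
     + 𝟙 (down? i ν la) * (ℕtoℚ (mult i ν) * inv3n n))

d : (n p q : ℕ) → (u : ℚ) → Vec ℕ n → Vec ℕ n → ℚ
d n p q u ν la with VP.≡-dec _≟_ la ν
... | yes _ = 1ℚ - Σℚ (filter (λ la′ → ¬? (VP.≡-dec _≟_ la′ ν)) (chiList n p q)) (offDiag n p u ν)
... | no _  = offDiag n p u ν la

-- π is a stationary distribution of the restricted random growth model
-- on χ^{p,q} (π given as a function on n-tuples; only its values on χ^{p,q} matter)
IsStationary : (n p q : ℕ) → (u : ℚ) → (Vec ℕ n → ℚ) → Set
IsStationary n p q u π =
    (∀ la → Chi n p q la → 0ℚ Data.Rational.≤ π la)
  × (Σℚ (chiList n p q) π ≡ 1ℚ)
  × (∀ la → Chi n p q la → π la ≡ Σℚ (chiList n p q) (λ ν → π ν * d n p q u ν la))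

-- Let w(λ) = |S_n(λ)| u^|λ|. If λ arises from ν by raising one part i to i+1, then
-- |λ| = |ν| + 1 and, by the multinomial formula |S_n(λ)| ∏_j m_j(λ)! = n!,
-- |S_n(ν)| m_i(ν) = |S_n(λ)| m_{i+1}(λ); hence w(ν) d(ν,λ) = w(λ) d(λ,ν). Stationarity then
-- makes h = π / w harmonic for the off-diagonal rates, so by the maximum principle h is
-- constant along paths of positive rates. Lowering parts ≥ 2 one at a time joins every
-- λ ∈ χ^{p,q} to the column (1^q, 0^{n-q}) by such paths in both directions, so h is constant
-- on χ^{p,q}. For u = 0 both sides vanish, since |λ| ≥ ℓ(λ) = q ≥ 1.

module Submission where

open import Defs
open import Data.Nat using (ℕ; _<_; _≤_)
open import Data.Vec using (Vec)
open import Data.Rational using (ℚ; 0ℚ; 1ℚ; _*_)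
import Data.Rational
open import Relation.Binary.PropositionalEquality using (_≡_)

import Data.Nat.Properties as ℕP
import Data.Rational.Properties as ℚP
open import Algebra.Structures using (IsCommutativeMonoid)
open import Algebra.Bundles using (CommutativeSemigroup; CommutativeMonoid)
open import Relation.Binary.Bundles using (DecTotalOrder)
import Algebra.Properties.CommutativeSemigroup as CommutativeSemigroupProperties
open import Data.Nat as ℕ using (zero; suc; _∸_; _⊔_; _!; z≤n; s≤s; NonZero)
open import Data.Nat.Properties using (_≟_)
open import Data.List as List using (List; []; _∷_; filter; length; map; concatMap; upTo; applyUpTo; _++_)
import Data.List.Properties as ListP
open import Data.List.Relation.Unary.All as All using (All; []; _∷_)
import Data.List.Relation.Unary.All.Properties as AllP
open import Data.List.Relation.Unary.Any using (here; there)
import Data.List.Relation.Unary.Any.Properties as AnyP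
open import Data.List.Membership.Propositional using (_∈_)
import Data.List.Membership.Propositional.Properties as ∈P
import Data.Vec.Properties as VecP
open import Data.Vec as Vec using ([]; _∷_; toList; lookup; _[_]≔_)
import Data.Vec.Relation.Unary.Any as VecAny
import Data.Vec.Relation.Unary.Any.Properties as VecAnyP
import Data.Vec.Membership.Propositional.Properties as Vec∈P
open import Data.Fin using (Fin) renaming (zero to fzero; suc to fsuc)
open import Data.Empty using (⊥-elim)
open import Data.Product using (_×_; _,_; ∃; proj₁; proj₂)
open import Function using (_∘_; id; case_of_)
open import Relation.Binary.PropositionalEquality using (_≢_; refl; sym; trans; cong; cong₂; subst; module ≡-Reasoning)
open import Relation.Nullary using (Dec; yes; no; ¬_; ¬?)
open import Relation.Binary.Construct.Closure.ReflexiveTransitive using (Star; ε; _◅_; _◅◅_)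
open import Data.List.Extrema (DecTotalOrder.totalOrder ℚP.≤-decTotalOrder) using (argmax; argmax-sel; f[xs]≤f[argmax])
open import Algebra.Properties.Group ℚP.+-0-group using (x∙y⁻¹≈ε⇒x≈y)
open import Data.Sum using (_⊎_; inj₁; inj₂; [_,_]′)
import Data.List.Relation.Unary.Linked as Linked
open import Relation.Unary using (Pred; Decidable; _≐_)
open import Relation.Binary.Definitions using (DecidableEquality)
import Relation.Nullary.Decidable as Dec
open import Level using (0ℓ)
import Data.Integer as ℤ
import Data.Integer.Properties as ℤP
import Data.Nat.Coprimality as Coprime
import Data.Rational as ℚ
open import Data.Rational using (_+_; _-_; _/_)
open import Tactic.RingSolver.Core.AlmostCommutativeRing using (AlmostCommutativeRing; fromCommutativeRing)
open import Tactic.RingSolver using (solve-∀)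

≡1+⇒1≤ : ∀ {m k} → m ≡ suc k → 1 ≤ m
≡1+⇒1≤ refl = s≤s z≤n

δ : ℕ → ℕ → ℕ
δ j x with j ≟ x
... | yes _ = 1
... | no _  = 0

δ-refl : ∀ j → δ j j ≡ 1
δ-refl j with j ≟ j
... | yes _ = refl
... | no j≢j = ⊥-elim (j≢j refl)

δ-≢ : ∀ {j x} → j ≢ x → δ j x ≡ 0
δ-≢ {j} {x} j≢x with j ≟ x
... | yes j≡x = ⊥-elim (j≢x j≡x)
... | no _ = refl

occurrences : ℕ → List ℕ → ℕ
occurrences j xs = length (filter (j ≟_) xs)

occurrences-∷ : ∀ j x xs → occurrences j (x ∷ xs) ≡ δ j x ℕ.+ occurrences j xs
occurrences-∷ j x xs with j ≟ x
... | yes j≡x = cong length (ListP.filter-accept (j ≟_) j≡x)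
... | no j≢x = cong length (ListP.filter-reject (j ≟_) j≢x)

occurrences>0⇒∈ : ∀ j xs → 1 ≤ occurrences j xs → j ∈ xs
occurrences>0⇒∈ j (x ∷ xs) h with j ≟ x
... | yes j≡x = here j≡x
... | no j≢x = there (occurrences>0⇒∈ j xs (subst (1 ≤_) (cong length (ListP.filter-reject (j ≟_) j≢x)) h))

∈⇒occurrences>0 : ∀ j xs → j ∈ xs → 1 ≤ occurrences j xs
∈⇒occurrences>0 j (x ∷ xs) (here j≡x) rewrite ListP.filter-accept (j ≟_) {xs = xs} j≡x = s≤s z≤n
∈⇒occurrences>0 j (x ∷ xs) (there j∈xs) rewrite occurrences-∷ j x xs =
  ℕP.≤-trans (∈⇒occurrences>0 j xs j∈xs) (ℕP.m≤n+m _ _)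

occurrences-above : ∀ j xs → All (_< j) xs → occurrences j xs ≡ 0
occurrences-above j [] _ = refl
occurrences-above j (x ∷ xs) (x<j ∷ xs<j)
  rewrite occurrences-∷ j x xs | occurrences-above j xs xs<j | δ-≢ (ℕP.>⇒≢ x<j) = refl

sameMultiset⇒occurrences : ∀ xs ys → SameMultiset xs ys → ∀ j → occurrences j xs ≡ occurrences j ys
sameMultiset⇒occurrences xs ys same j with occurrences j xs in ex | occurrences j ys in ey
... | zero  | zero = refl
... | suc _ | _ =
  trans (sym ex) (trans (All.lookup same (∈P.∈-++⁺ˡ (occurrences>0⇒∈ j xs (≡1+⇒1≤ ex)))) ey)
... | zero  | suc _ =
  trans (sym ex) (trans (All.lookup same (∈P.∈-++⁺ʳ xs (occurrences>0⇒∈ j ys (≡1+⇒1≤ ey)))) ey)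

occurrences⇒sameMultiset : ∀ xs ys → (∀ j → occurrences j xs ≡ occurrences j ys) → SameMultiset xs ys
occurrences⇒sameMultiset xs ys h = All.tabulate (λ {j} _ → h j)

sameMultiset-refl : ∀ xs → SameMultiset xs xs
sameMultiset-refl xs = occurrences⇒sameMultiset xs xs (λ _ → refl)

module RangeFold {A : Set} {_∙_ : A → A → A} {ε : A} (isCM : IsCommutativeMonoid _≡_ _∙_ ε) where
  open IsCommutativeMonoid isCM using (assoc; identityˡ; identityʳ; isCommutativeSemigroup)

  commutativeSemigroup : CommutativeSemigroup 0ℓ 0ℓ
  commutativeSemigroup = record { isCommutativeSemigroup = isCommutativeSemigroup }

  open CommutativeSemigroupProperties commutativeSemigroup using (interchange; x∙yz≈y∙xz)

  fold< : ℕ → (ℕ → A) → A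
  fold< zero    f = ε
  fold< (suc V) f = f 0 ∙ fold< V (f ∘ suc)

  fold<-cong : ∀ V {f g} → (∀ j → j < V → f j ≡ g j) → fold< V f ≡ fold< V g
  fold<-cong zero    f≡g = refl
  fold<-cong (suc V) f≡g = cong₂ _∙_ (f≡g 0 (s≤s z≤n)) (fold<-cong V (λ j j<V → f≡g (suc j) (s≤s j<V)))

  fold<-ε : ∀ V f → (∀ j → j < V → f j ≡ ε) → fold< V f ≡ ε
  fold<-ε V f f≡ε = trans (fold<-cong V f≡ε) (go V)
    where
    go : ∀ V → fold< V (λ _ → ε) ≡ ε
    go zero = refl
    go (suc V) = trans (cong (ε ∙_) (go V)) (identityˡ ε)

  fold<-∙ : ∀ V f g → fold< V (λ j → f j ∙ g j) ≡ fold< V f ∙ fold< V g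
  fold<-∙ zero    f g = sym (identityˡ ε)
  fold<-∙ (suc V) f g rewrite fold<-∙ V (f ∘ suc) (g ∘ suc) = interchange (f 0) (g 0) _ _

  fold<-update : ∀ V x {g h : ℕ → A} a → x < V → (∀ j → j ≢ x → g j ≡ h j) → g x ≡ a ∙ h x →
                 fold< V g ≡ a ∙ fold< V h
  fold<-update (suc V) zero {g} {h} a _ g≡h gx rewrite gx
    | fold<-cong V {g ∘ suc} {h ∘ suc} (λ j _ → g≡h (suc j) (λ ())) = assoc a (h 0) _
  fold<-update (suc V) (suc x) {g} {h} a (s≤s x<V) g≡h gx
    rewrite g≡h 0 (λ ())
    | fold<-update V x {g ∘ suc} {h ∘ suc} a x<V (λ j j≢x → g≡h (suc j) (j≢x ∘ ℕP.suc-injective)) gx =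
    x∙yz≈y∙xz (h 0) a _

  fold<-beyond : ∀ V W f → (∀ j → V ≤ j → f j ≡ ε) → V ≤ W → fold< W f ≡ fold< V f
  fold<-beyond zero    W       f f≡ε _         = fold<-ε W f (λ j _ → f≡ε j z≤n)
  fold<-beyond (suc V) (suc W) f f≡ε (s≤s V≤W) =
    cong (f 0 ∙_) (fold<-beyond V W (f ∘ suc) (λ j V≤j → f≡ε (suc j) (s≤s V≤j)) V≤W)

  fold<-snoc : ∀ V f → fold< (suc V) f ≡ fold< V f ∙ f V
  fold<-snoc zero    f = trans (identityʳ (f 0)) (sym (identityˡ (f 0)))
  fold<-snoc (suc V) f = trans (cong (f 0 ∙_) (fold<-snoc V (f ∘ suc))) (sym (assoc (f 0) _ _))

  fold<-shift : ∀ V f g → f 0 ≡ ε → g V ≡ ε → (∀ i → g i ≡ f (suc i)) → fold< (suc V) g ≡ fold< (suc V) f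
  fold<-shift V f g f0≡ε gV≡ε g≡f∘suc = begin
    fold< (suc V) g        ≡⟨ fold<-snoc V g ⟩
    fold< V g ∙ g V        ≡⟨ cong (fold< V g ∙_) gV≡ε ⟩
    fold< V g ∙ ε          ≡⟨ identityʳ _ ⟩
    fold< V g              ≡⟨ fold<-cong V (λ i _ → g≡f∘suc i) ⟩
    fold< V (f ∘ suc)      ≡⟨ identityˡ _ ⟨
    ε ∙ fold< V (f ∘ suc)  ≡⟨ cong (_∙ fold< V (f ∘ suc)) f0≡ε ⟨
    fold< (suc V) f        ∎
    where open ≡-Reasoning

module ℕ* = CommutativeSemigroupProperties ℕP.*-commutativeSemigroup
module ℕ+ = CommutativeSemigroupProperties ℕP.+-commutativeSemigroup
module ℚ+ = CommutativeSemigroupProperties (CommutativeMonoid.commutativeSemigroup ℚP.+-0-commutativeMonoid)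
module ℚ* = CommutativeSemigroupProperties (CommutativeMonoid.commutativeSemigroup ℚP.*-1-commutativeMonoid)
module Sum = RangeFold ℕP.+-0-isCommutativeMonoid
module Product = RangeFold ℕP.*-1-isCommutativeMonoid
open Sum using () renaming (fold< to ∑<)
open Product using () renaming (fold< to ∏<)
module Sumℚ = RangeFold ℚP.+-0-isCommutativeMonoid
open Sumℚ using () renaming (fold< to ∑ℚ<)

∑<-*ʳ : ∀ V f K → ∑< V (λ j → f j ℕ.* K) ≡ ∑< V f ℕ.* K
∑<-*ʳ zero    f K = refl
∑<-*ʳ (suc V) f K rewrite ∑<-*ʳ V (f ∘ suc) K = sym (ℕP.*-distribʳ-+ K (f 0) _)

∑<≡0⇒≡0 : ∀ V f → ∑< V f ≡ 0 → ∀ j → j < V → f j ≡ 0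
∑<≡0⇒≡0 (suc V) f sum≡0 zero    _         = ℕP.m+n≡0⇒m≡0 (f 0) sum≡0
∑<≡0⇒≡0 (suc V) f sum≡0 (suc j) (s≤s j<V) = ∑<≡0⇒≡0 V (f ∘ suc) (ℕP.m+n≡0⇒n≡0 (f 0) sum≡0) j j<V

∑<-δ : ∀ V x → x < V → ∑< V (λ j → δ j x) ≡ 1
∑<-δ V x x<V =
  trans (Sum.fold<-update V x {h = λ _ → 0} 1 x<V (λ _ → δ-≢) (δ-refl x))
        (cong suc (Sum.fold<-ε V _ (λ _ _ → refl)))

∑<-weighted-δ : ∀ V x → x < V → ∑< V (λ j → j ℕ.* δ j x) ≡ x
∑<-weighted-δ V x x<V =
  trans (Sum.fold<-update V x {h = λ _ → 0} x x<V
           (λ j j≢x → trans (cong (j ℕ.*_) (δ-≢ j≢x)) (ℕP.*-zeroʳ j))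
           (trans (cong (x ℕ.*_) (δ-refl x)) (trans (ℕP.*-identityʳ x) (sym (ℕP.+-identityʳ x)))))
        (trans (cong (x ℕ.+_) (Sum.fold<-ε V _ (λ _ _ → refl))) (ℕP.+-identityʳ x))

∑<-mult : ∀ {n} V (v : Vec ℕ n) → All (_< V) (toList v) → ∑< V (λ j → mult j v) ≡ n
∑<-mult V []      _          = Sum.fold<-ε V _ (λ _ _ → refl)
∑<-mult V (x ∷ v) (x<V ∷ v<V) = begin
  ∑< V (λ j → mult j (x ∷ v))                  ≡⟨ Sum.fold<-cong V (λ j _ → occurrences-∷ j x (toList v)) ⟩
  ∑< V (λ j → δ j x ℕ.+ mult j v)              ≡⟨ Sum.fold<-∙ V (λ j → δ j x) (λ j → mult j v) ⟩
  ∑< V (λ j → δ j x) ℕ.+ ∑< V (λ j → mult j v) ≡⟨ cong₂ ℕ._+_ (∑<-δ V x x<V) (∑<-mult V v v<V) ⟩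
  suc _                                         ∎
  where open ≡-Reasoning

∑<-weighted-mult : ∀ {n} V (v : Vec ℕ n) → All (_< V) (toList v) → ∑< V (λ j → j ℕ.* mult j v) ≡ size v
∑<-weighted-mult V []      _          = Sum.fold<-ε V _ (λ j _ → ℕP.*-zeroʳ j)
∑<-weighted-mult V (x ∷ v) (x<V ∷ v<V) = begin
  ∑< V (λ j → j ℕ.* mult j (x ∷ v))
    ≡⟨ Sum.fold<-cong V (λ j _ → distrib j) ⟩
  ∑< V (λ j → j ℕ.* δ j x ℕ.+ j ℕ.* mult j v)
    ≡⟨ Sum.fold<-∙ V _ _ ⟩
  ∑< V (λ j → j ℕ.* δ j x) ℕ.+ ∑< V (λ j → j ℕ.* mult j v)
    ≡⟨ cong₂ ℕ._+_ (∑<-weighted-δ V x x<V) (∑<-weighted-mult V v v<V) ⟩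
  x ℕ.+ size v
    ∎
  where
  open ≡-Reasoning
  distrib : ∀ j → j ℕ.* mult j (x ∷ v) ≡ j ℕ.* δ j x ℕ.+ j ℕ.* mult j v
  distrib j = trans (cong (j ℕ.*_) (occurrences-∷ j x (toList v))) (ℕP.*-distribˡ-+ j (δ j x) (mult j v))

-- Multinomial coefficients

length-filter-map : ∀ {A B : Set} {p} {P : Pred B p} (P? : Decidable P) (f : A → B) xs →
                    length (filter P? (map f xs)) ≡ length (filter (P? ∘ f) xs)
length-filter-map P? f [] = refl
length-filter-map P? f (x ∷ xs) with P? (f x)
... | yes _ = cong suc (length-filter-map P? f xs)
... | no _  = length-filter-map P? f xs

length-filter-concatMap : ∀ {A B : Set} {p} {P : Pred A p} (P? : Decidable P) (f : B → List A) (g : ℕ → B) V →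
                          length (filter P? (concatMap f (applyUpTo g V))) ≡ ∑< V (λ x → length (filter P? (f (g x))))
length-filter-concatMap P? f g zero = refl
length-filter-concatMap P? f g (suc V) = begin
  length (filter P? (f (g 0) ++ concatMap f (applyUpTo (g ∘ suc) V)))
    ≡⟨ cong length (ListP.filter-++ P? (f (g 0)) _) ⟩
  length (filter P? (f (g 0)) ++ filter P? (concatMap f (applyUpTo (g ∘ suc) V)))
    ≡⟨ ListP.length-++ (filter P? (f (g 0))) ⟩
  length (filter P? (f (g 0))) ℕ.+ length (filter P? (concatMap f (applyUpTo (g ∘ suc) V)))
    ≡⟨ cong (length (filter P? (f (g 0))) ℕ.+_) (length-filter-concatMap P? f (g ∘ suc) V) ⟩
  ∑< (suc V) (λ x → length (filter P? (f (g x))))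
    ∎
  where open ≡-Reasoning

length-filter-≐-on : ∀ {A : Set} {p q} {P : Pred A p} {Q : Pred A q} (P? : Decidable P) (Q? : Decidable Q) xs →
                     All (λ x → (P x → Q x) × (Q x → P x)) xs → length (filter P? xs) ≡ length (filter Q? xs)
length-filter-≐-on P? Q? [] _ = refl
length-filter-≐-on P? Q? (x ∷ xs) ((P⇒Q , Q⇒P) ∷ rest) with P? x | Q? x
... | yes _  | yes _  = cong suc (length-filter-≐-on P? Q? xs rest)
... | yes px | no ¬qx = ⊥-elim (¬qx (P⇒Q px))
... | no ¬px | yes qx = ⊥-elim (¬px (Q⇒P qx))
... | no _   | no _   = length-filter-≐-on P? Q? xs rest

HasCounts : ∀ {n} → ℕ → (ℕ → ℕ) → Vec ℕ n → Set
HasCounts V c v = All (λ j → mult j v ≡ c j) (upTo V)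

hasCounts? : ∀ {n} V c → Decidable (HasCounts {n} V c)
hasCounts? V c v = All.all? (λ j → mult j v ≟ c j) (upTo V)

withCounts : (n p : ℕ) → (ℕ → ℕ) → List (Vec ℕ n)
withCounts n p c = filter (hasCounts? (suc p) c) (tuples n p)

removeOne : (ℕ → ℕ) → ℕ → ℕ → ℕ
removeOne c x j = c j ∸ δ j x

removeOne-≢ : ∀ c x j → j ≢ x → removeOne c x j ≡ c j
removeOne-≢ c x j j≢x = cong (c j ∸_) (δ-≢ j≢x)

removeOne-≡ : ∀ c x {k} → c x ≡ suc k → removeOne c x x ≡ k
removeOne-≡ c x cx≡1+k = cong₂ _∸_ cx≡1+k (δ-refl x)

hasCounts-∷ : ∀ {m} V c x → 1 ≤ c x → x < V →
              (λ (t : Vec ℕ m) → HasCounts V c (x ∷ t)) ≐ HasCounts V (removeOne c x)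
hasCounts-∷ V c x cx≥1 x<V = to , from
  where
  to : ∀ {t} → HasCounts V c (x ∷ t) → HasCounts V (removeOne c x) t
  to {t} has = AllP.applyUpTo⁺₁ id V λ {j} j<V →
    sym (trans (cong (_∸ δ j x) (sym (AllP.applyUpTo⁻ id V has j<V)))
               (trans (cong (_∸ δ j x) (occurrences-∷ j x (toList t))) (ℕP.m+n∸m≡n (δ j x) _)))
  from : ∀ {t} → HasCounts V (removeOne c x) t → HasCounts V c (x ∷ t)
  from {t} has = AllP.applyUpTo⁺₁ id V λ {j} j<V →
    trans (occurrences-∷ j x (toList t)) (trans (cong (δ j x ℕ.+_) (AllP.applyUpTo⁻ id V has j<V)) (restore j))
    where
    restore : ∀ j → δ j x ℕ.+ (c j ∸ δ j x) ≡ c j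
    restore j with j ≟ x
    ... | yes refl = ℕP.m+[n∸m]≡n cx≥1
    ... | no _ = refl

¬hasCounts-∷ : ∀ {m} V c x (t : Vec ℕ m) → c x ≡ 0 → x < V → ¬ HasCounts V c (x ∷ t)
¬hasCounts-∷ V c x t cx≡0 x<V has = ℕP.1+n≢0 (begin
  suc (mult x t)            ≡⟨ cong (ℕ._+ mult x t) (sym (δ-refl x)) ⟩
  δ x x ℕ.+ mult x t        ≡⟨ sym (occurrences-∷ x x (toList t)) ⟩
  mult x (x ∷ t)            ≡⟨ AllP.applyUpTo⁻ id V has x<V ⟩
  c x                       ≡⟨ cx≡0 ⟩
  0                         ∎)
  where open ≡-Reasoning

∑<-removeOne : ∀ V c x {k} → x < V → c x ≡ suc k → ∑< V c ≡ suc (∑< V (removeOne c x))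
∑<-removeOne V c x x<V cx≡1+k =
  Sum.fold<-update V x 1 x<V (λ j j≢x → sym (removeOne-≢ c x j j≢x)) (trans cx≡1+k (cong suc (sym (removeOne-≡ c x cx≡1+k))))

∏<!-removeOne : ∀ V c x {k} → x < V → c x ≡ suc k →
                ∏< V (λ j → c j !) ≡ suc k ℕ.* ∏< V (λ j → removeOne c x j !)
∏<!-removeOne V c x {k} x<V cx≡1+k =
  Product.fold<-update V x (suc k) x<V (λ j j≢x → cong _! (sym (removeOne-≢ c x j j≢x)))
    (trans (cong _! cx≡1+k) (cong (λ i → suc k ℕ.* i !) (sym (removeOne-≡ c x cx≡1+k))))

startingWith : ∀ m p (c : ℕ → ℕ) → ℕ → ℕ
startingWith m p c x = length (filter (hasCounts? (suc p) c) (map (x ∷_) (tuples m p)))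

startingWith-∏! : ∀ m p c x → x < suc p →
                  (∀ c′ → ∑< (suc p) c′ ≡ m → length (withCounts m p c′) ℕ.* ∏< (suc p) (λ j → c′ j !) ≡ m !) →
                  ∑< (suc p) c ≡ suc m → startingWith m p c x ℕ.* ∏< (suc p) (λ j → c j !) ≡ c x ℕ.* m !
startingWith-∏! m p c x x<V multinomial-m ∑c≡1+m with c x in cx
... | zero = cong (ℕ._* ∏< V (λ j → c j !))
  (trans (length-filter-map (hasCounts? V c) (x ∷_) (tuples m p))
         (cong length (ListP.filter-none (hasCounts? V c ∘ (x ∷_)) {xs = tuples m p}
                         (All.tabulate (λ {t} _ → ¬hasCounts-∷ V c x t cx x<V)))))
  where V = suc p
... | suc k = begin
  startingWith m p c x ℕ.* ∏< V (λ j → c j !)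
    ≡⟨ cong₂ ℕ._*_
         (trans (length-filter-map (hasCounts? V c) (x ∷_) (tuples m p))
                (cong length (ListP.filter-≐ _ _ (hasCounts-∷ {m} V c x (≡1+⇒1≤ cx) x<V) (tuples m p))))
         (∏<!-removeOne V c x x<V cx) ⟩
  length (withCounts m p c′) ℕ.* (suc k ℕ.* ∏< V (λ j → c′ j !))
    ≡⟨ ℕ*.x∙yz≈y∙xz (length (withCounts m p c′)) (suc k) _ ⟩
  suc k ℕ.* (length (withCounts m p c′) ℕ.* ∏< V (λ j → c′ j !))
    ≡⟨ cong (suc k ℕ.*_) (multinomial-m c′ (ℕP.suc-injective (trans (sym (∑<-removeOne V c x x<V cx)) ∑c≡1+m))) ⟩
  suc k ℕ.* m !
    ∎
  where
  open ≡-Reasoning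
  V = suc p
  c′ = removeOne c x

multinomial : ∀ n p c → ∑< (suc p) c ≡ n → length (withCounts n p c) ℕ.* ∏< (suc p) (λ j → c j !) ≡ n !
multinomial zero p c ∑c≡0 =
  cong₂ ℕ._*_ single (Product.fold<-ε (suc p) _ (λ j j<V → cong _! (c≡0 j j<V)))
  where
  c≡0 : ∀ j → j < suc p → c j ≡ 0
  c≡0 = ∑<≡0⇒≡0 (suc p) c ∑c≡0
  single : length (withCounts 0 p c) ≡ 1
  single = cong length (ListP.filter-accept (hasCounts? {0} (suc p) c) {x = Vec.[]} {xs = List.[]}
                          (AllP.applyUpTo⁺₁ id (suc p) (λ {j} j<V → sym (c≡0 j j<V))))
multinomial (suc m) p c ∑c≡1+m = begin
  length (withCounts (suc m) p c) ℕ.* ∏!c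
    ≡⟨ cong (ℕ._* ∏!c) (length-filter-concatMap (hasCounts? V c) (λ x → map (x ∷_) (tuples m p)) id V) ⟩
  ∑< V (startingWith m p c) ℕ.* ∏!c
    ≡⟨ ∑<-*ʳ V (startingWith m p c) ∏!c ⟨
  ∑< V (λ x → startingWith m p c x ℕ.* ∏!c)
    ≡⟨ Sum.fold<-cong V (λ x x<V → startingWith-∏! m p c x x<V (multinomial m p) ∑c≡1+m) ⟩
  ∑< V (λ x → c x ℕ.* m !)
    ≡⟨ ∑<-*ʳ V c (m !) ⟩
  ∑< V c ℕ.* m !
    ≡⟨ cong (ℕ._* m !) ∑c≡1+m ⟩
  suc m !
    ∎
  where
  open ≡-Reasoning
  V = suc p
  ∏!c = ∏< V (λ j → c j !)

tuples-bounded : ∀ n p → All (λ v → All (_≤ p) (toList v)) (tuples n p)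
tuples-bounded zero    p = [] ∷ []
tuples-bounded (suc n) p = AllP.concat⁺ (AllP.map⁺ (AllP.applyUpTo⁺₁ id (suc p) λ x<1+p →
  AllP.map⁺ (All.map (ℕP.≤-pred x<1+p ∷_) (tuples-bounded n p))))

entries≤size : ∀ {n} (v : Vec ℕ n) → All (_≤ size v) (toList v)
entries≤size []      = []
entries≤size (x ∷ v) = ℕP.m≤m+n x (size v) ∷ All.map (λ y≤ → ℕP.≤-trans y≤ (ℕP.m≤n+m _ x)) (entries≤size v)

mult-beyond-size : ∀ {n} (v : Vec ℕ n) j → size v < j → mult j v ≡ 0
mult-beyond-size v j size<j = occurrences-above j (toList v) (All.map (λ y≤ → ℕP.≤-<-trans y≤ size<j) (entries≤size v))

numRearr≡withCounts : ∀ {n} (v : Vec ℕ n) → numRearr v ≡ length (withCounts n (size v) (λ j → mult j v))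
numRearr≡withCounts {n} v =
  length-filter-≐-on _ (hasCounts? (suc (size v)) (λ j → mult j v)) (tuples n (size v))
    (All.map (λ μ≤ → to , from μ≤) (tuples-bounded n (size v)))
  where
  to : ∀ {μ} → SameMultiset (toList μ) (toList v) → HasCounts (suc (size v)) (λ j → mult j v) μ
  to {μ} same = AllP.applyUpTo⁺₂ id (suc (size v)) (sameMultiset⇒occurrences (toList μ) (toList v) same)
  from : ∀ {μ} → All (_≤ size v) (toList μ) → HasCounts (suc (size v)) (λ j → mult j v) μ →
         SameMultiset (toList μ) (toList v)
  from {μ} μ≤ has = occurrences⇒sameMultiset (toList μ) (toList v) λ j → case j ℕP.≤? size v of λ where
    (yes j≤) → AllP.applyUpTo⁻ id (suc (size v)) has (s≤s j≤)
    (no j≰)  → trans (occurrences-above j (toList μ) (All.map (λ y≤ → ℕP.≤-<-trans y≤ (ℕP.≰⇒> j≰)) μ≤))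
                     (sym (mult-beyond-size v j (ℕP.≰⇒> j≰)))

numRearr-multinomial : ∀ {n} (v : Vec ℕ n) V → size v < V → numRearr v ℕ.* ∏< V (λ j → mult j v !) ≡ n !
numRearr-multinomial {n} v V size<V = begin
  numRearr v ℕ.* ∏< V (λ j → mult j v !)
    ≡⟨ cong₂ ℕ._*_ (numRearr≡withCounts v)
         (Product.fold<-beyond (suc (size v)) V _ (λ j size<j → cong _! (mult-beyond-size v j size<j)) size<V) ⟩
  length (withCounts n (size v) (λ j → mult j v)) ℕ.* ∏< (suc (size v)) (λ j → mult j v !)
    ≡⟨ multinomial n (size v) (λ j → mult j v) (∑<-mult (suc (size v)) v (All.map s≤s (entries≤size v))) ⟩
  n !
    ∎
  where open ≡-Reasoning

numRearr>0 : ∀ {n} (v : Vec ℕ n) → 1 ≤ numRearr v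
numRearr>0 {n} v = ℕP.n≢0⇒n>0 λ numRearr≡0 →
  ℕP.<⇒≢ (ℕP.1≤n! n) (trans (sym (cong (ℕ._* ∏< (suc (size v)) (λ j → mult j v !)) numRearr≡0))
                             (numRearr-multinomial v (suc (size v)) ℕP.≤-refl))

lookup∈toList : ∀ {n} (a : Vec ℕ n) k → lookup a k ∈ toList a
lookup∈toList a k = Vec∈P.∈-toList⁺ (Vec∈P.∈-lookup k a)

∈toList⇒lookup : ∀ {n} {y} (a : Vec ℕ n) → y ∈ toList a → ∃ λ k → lookup a k ≡ y
∈toList⇒lookup a y∈a = let y∈ = Vec∈P.∈-toList⁻ y∈a in VecAny.index y∈ , sym (VecAnyP.lookup-index y∈)

mult-update : ∀ {n} j (a : Vec ℕ n) k z → mult j (a [ k ]≔ z) ℕ.+ δ j (lookup a k) ≡ mult j a ℕ.+ δ j z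
mult-update j (x ∷ a) fzero z
  rewrite occurrences-∷ j z (toList a) | occurrences-∷ j x (toList a) = ℕ+.xy∙z≈zy∙x (δ j z) (mult j a) (δ j x)
mult-update j (x ∷ a) (fsuc k) z
  rewrite occurrences-∷ j x (toList (a [ k ]≔ z)) | occurrences-∷ j x (toList a) = begin
  δ j x ℕ.+ mult j (a [ k ]≔ z) ℕ.+ δ j (lookup a k)   ≡⟨ ℕP.+-assoc (δ j x) _ _ ⟩
  δ j x ℕ.+ (mult j (a [ k ]≔ z) ℕ.+ δ j (lookup a k)) ≡⟨ cong (δ j x ℕ.+_) (mult-update j a k z) ⟩
  δ j x ℕ.+ (mult j a ℕ.+ δ j z)                       ≡⟨ ℕP.+-assoc (δ j x) _ _ ⟨
  δ j x ℕ.+ mult j a ℕ.+ δ j z                         ∎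
  where open ≡-Reasoning

-- b is a rearrangement of a with one part y replaced by z, stated through multiplicities.
record ReplaceOne {n} (y z : ℕ) (a b : Vec ℕ n) : Set where
  constructor replaceOne
  field balance : ∀ j → mult j b ℕ.+ δ j y ≡ mult j a ℕ.+ δ j z
open ReplaceOne

update⇒replaceOne : ∀ {n y z} (a b : Vec ℕ n) k → lookup a k ≡ y →
                    SameMultiset (toList b) (toList (a [ k ]≔ z)) → ReplaceOne y z a b
update⇒replaceOne {z = z} a b k ak≡y same = replaceOne λ j →
  trans (cong₂ ℕ._+_ (sameMultiset⇒occurrences (toList b) _ same j) (cong (δ j) (sym ak≡y))) (mult-update j a k z)

replaceOne-at-y : ∀ {n y z} {a b : Vec ℕ n} → y ≢ z → ReplaceOne y z a b → mult y a ≡ suc (mult y b)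
replaceOne-at-y {y = y} {z} {a} {b} y≢z replace = begin
  mult y a                  ≡⟨ ℕP.+-identityʳ _ ⟨
  mult y a ℕ.+ 0            ≡⟨ cong (mult y a ℕ.+_) (δ-≢ y≢z) ⟨
  mult y a ℕ.+ δ y z        ≡⟨ balance replace y ⟨
  mult y b ℕ.+ δ y y        ≡⟨ cong (mult y b ℕ.+_) (δ-refl y) ⟩
  mult y b ℕ.+ 1            ≡⟨ ℕP.+-comm _ 1 ⟩
  suc (mult y b)            ∎
  where open ≡-Reasoning

replaceOne-sym : ∀ {n y z} {a b : Vec ℕ n} → ReplaceOne y z a b → ReplaceOne z y b a
replaceOne-sym replace = replaceOne λ j → sym (balance replace j)

replaceOne-at-z : ∀ {n y z} {a b : Vec ℕ n} → y ≢ z → ReplaceOne y z a b → mult z b ≡ suc (mult z a)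
replaceOne-at-z y≢z replace = replaceOne-at-y (y≢z ∘ sym) (replaceOne-sym replace)

replaceOne⇒update : ∀ {n y z} (a b : Vec ℕ n) → y ≢ z → ReplaceOne y z a b →
                    ∃ λ k → lookup a k ≡ y × SameMultiset (toList b) (toList (a [ k ]≔ z))
replaceOne⇒update {y = y} {z} a b y≢z replace = k , ak≡y , occurrences⇒sameMultiset (toList b) _ λ j →
  ℕP.+-cancelʳ-≡ (δ j y) _ _
    (trans (balance replace j) (sym (subst (λ x → mult j (a [ k ]≔ z) ℕ.+ δ j x ≡ _) ak≡y (mult-update j a k z))))
  where
  y∈a : y ∈ toList a
  y∈a = occurrences>0⇒∈ y (toList a) (≡1+⇒1≤ (replaceOne-at-y y≢z replace))
  k = proj₁ (∈toList⇒lookup a y∈a)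
  ak≡y = proj₂ (∈toList⇒lookup a y∈a)

mult>0⇒≤size : ∀ {n} (a : Vec ℕ n) j → 1 ≤ mult j a → j ≤ size a
mult>0⇒≤size a j mult>0 = All.lookup (entries≤size a) (occurrences>0⇒∈ j (toList a) mult>0)

replaceOne-y≤size : ∀ {n y z} {a b : Vec ℕ n} → y ≢ z → ReplaceOne y z a b → y ≤ size a
replaceOne-y≤size {y = y} {a = a} y≢z replace =
  mult>0⇒≤size a y (≡1+⇒1≤ (replaceOne-at-y y≢z replace))

replaceOne-below : ∀ {n y z} {a b : Vec ℕ n} → y ≢ z → ReplaceOne y z a b →
                   y < suc (size a ℕ.+ size b) × z < suc (size a ℕ.+ size b)
replaceOne-below y≢z replace =
  s≤s (ℕP.≤-trans (replaceOne-y≤size y≢z replace) (ℕP.m≤m+n _ _)) ,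
  s≤s (ℕP.≤-trans (replaceOne-y≤size (y≢z ∘ sym) (replaceOne-sym replace)) (ℕP.m≤n+m _ _))

replaceOne-≤ : ∀ {n y z} {a b : Vec ℕ n} j → j ≢ y → ReplaceOne y z a b → mult j a ≤ mult j b
replaceOne-≤ {y = y} {z} {a} {b} j j≢y replace = begin
  mult j a                ≤⟨ ℕP.m≤m+n _ _ ⟩
  mult j a ℕ.+ δ j z      ≡⟨ balance replace j ⟨
  mult j b ℕ.+ δ j y      ≡⟨ cong (mult j b ℕ.+_) (δ-≢ j≢y) ⟩
  mult j b ℕ.+ 0          ≡⟨ ℕP.+-identityʳ _ ⟩
  mult j b                ∎
  where open ℕP.≤-Reasoning

replaceOne-size : ∀ {n y z} {a b : Vec ℕ n} → y ≢ z → ReplaceOne y z a b → size b ℕ.+ y ≡ size a ℕ.+ z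
replaceOne-size {y = y} {z} {a} {b} y≢z replace = begin
  size b ℕ.+ y
    ≡⟨ cong₂ ℕ._+_ (weighted b (ℕP.m≤n+m _ _)) (∑<-weighted-δ V y y<V) ⟨
  ∑< V (λ j → j ℕ.* mult j b) ℕ.+ ∑< V (λ j → j ℕ.* δ j y)
    ≡⟨ Sum.fold<-∙ V (λ j → j ℕ.* mult j b) (λ j → j ℕ.* δ j y) ⟨
  ∑< V (λ j → j ℕ.* mult j b ℕ.+ j ℕ.* δ j y)
    ≡⟨ Sum.fold<-cong V (λ j _ → balanced j) ⟩
  ∑< V (λ j → j ℕ.* mult j a ℕ.+ j ℕ.* δ j z)
    ≡⟨ Sum.fold<-∙ V (λ j → j ℕ.* mult j a) (λ j → j ℕ.* δ j z) ⟩
  ∑< V (λ j → j ℕ.* mult j a) ℕ.+ ∑< V (λ j → j ℕ.* δ j z)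
    ≡⟨ cong₂ ℕ._+_ (weighted a (ℕP.m≤m+n _ _)) (∑<-weighted-δ V z z<V) ⟩
  size a ℕ.+ z
    ∎
  where
  open ≡-Reasoning
  V = suc (size a ℕ.+ size b)
  weighted : ∀ v → size v ≤ size a ℕ.+ size b → ∑< V (λ j → j ℕ.* mult j v) ≡ size v
  weighted v size≤ = ∑<-weighted-mult V v (All.map (λ y≤ → s≤s (ℕP.≤-trans y≤ size≤)) (entries≤size v))
  y<V : y < V
  y<V = proj₁ (replaceOne-below y≢z replace)
  z<V : z < V
  z<V = proj₂ (replaceOne-below y≢z replace)
  balanced : ∀ j → j ℕ.* mult j b ℕ.+ j ℕ.* δ j y ≡ j ℕ.* mult j a ℕ.+ j ℕ.* δ j z
  balanced j = trans (sym (ℕP.*-distribˡ-+ j _ _)) (trans (cong (j ℕ.*_) (balance replace j)) (ℕP.*-distribˡ-+ j _ _))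

∏<!⊔-replaceOne : ∀ V {n y z} {a b : Vec ℕ n} → y < V → y ≢ z → ReplaceOne y z a b →
                  ∏< V (λ j → (mult j a ⊔ mult j b) !) ≡ mult y a ℕ.* ∏< V (λ j → mult j b !)
∏<!⊔-replaceOne V {y = y} {a = a} {b} y<V y≢z replace =
  Product.fold<-update V y (mult y a) y<V
    (λ j j≢y → cong _! (ℕP.m≤n⇒m⊔n≡n (replaceOne-≤ j j≢y replace)))
    (trans (cong _! (trans (ℕP.m≥n⇒m⊔n≡m (ℕP.≤-trans (ℕP.n≤1+n _) (ℕP.≤-reflexive (sym a≡1+b)))) a≡1+b))
           (cong (λ m → m ℕ.* mult y b !) (sym a≡1+b)))
  where
  a≡1+b : mult y a ≡ suc (mult y b)
  a≡1+b = replaceOne-at-y y≢z replace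

-- Both sides times ∏ m_j(b)! equal m_z(b) n!, since ∏ (m_j(a) ⊔ m_j(b))! is both
-- m_y(a) ∏ m_j(b)! and m_z(b) ∏ m_j(a)!.
numRearr-replaceOne : ∀ {n y z} {a b : Vec ℕ n} → y ≢ z → ReplaceOne y z a b →
                      numRearr a ℕ.* mult y a ≡ numRearr b ℕ.* mult z b
numRearr-replaceOne {n} {y} {z} {a} {b} y≢z replace =
  ℕP.*-cancelʳ-≡ _ _ (∏! b) {{ℕP.m*n≢0⇒n≢0 (numRearr b) {{subst NonZero (sym multinomial-b) (ℕP._!≢0 n)}}}} (begin
    numRearr a ℕ.* mult y a ℕ.* ∏! b        ≡⟨ ℕP.*-assoc (numRearr a) _ _ ⟩
    numRearr a ℕ.* (mult y a ℕ.* ∏! b)      ≡⟨ cong (numRearr a ℕ.*_) exchange ⟩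
    numRearr a ℕ.* (mult z b ℕ.* ∏! a)      ≡⟨ ℕ*.x∙yz≈y∙xz (numRearr a) (mult z b) (∏! a) ⟩
    mult z b ℕ.* (numRearr a ℕ.* ∏! a)      ≡⟨ cong (mult z b ℕ.*_) (trans multinomial-a (sym multinomial-b)) ⟩
    mult z b ℕ.* (numRearr b ℕ.* ∏! b)      ≡⟨ ℕ*.x∙yz≈y∙xz (mult z b) (numRearr b) (∏! b) ⟩
    numRearr b ℕ.* (mult z b ℕ.* ∏! b)      ≡⟨ ℕP.*-assoc (numRearr b) _ _ ⟨
    numRearr b ℕ.* mult z b ℕ.* ∏! b        ∎)
  where
  open ≡-Reasoning
  V = suc (size a ℕ.+ size b)
  ∏! : Vec ℕ n → ℕ
  ∏! v = ∏< V (λ j → mult j v !)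
  multinomial-a : numRearr a ℕ.* ∏! a ≡ n !
  multinomial-a = numRearr-multinomial a V (s≤s (ℕP.m≤m+n _ _))
  multinomial-b : numRearr b ℕ.* ∏! b ≡ n !
  multinomial-b = numRearr-multinomial b V (s≤s (ℕP.m≤n+m _ _))
  y<V : y < V
  y<V = proj₁ (replaceOne-below y≢z replace)
  z<V : z < V
  z<V = proj₂ (replaceOne-below y≢z replace)
  exchange : mult y a ℕ.* ∏! b ≡ mult z b ℕ.* ∏! a
  exchange = trans (sym (∏<!⊔-replaceOne V y<V y≢z replace))
    (trans (Product.fold<-cong V (λ j _ → cong _! (ℕP.⊔-comm (mult j a) (mult j b))))
           (∏<!⊔-replaceOne V z<V (y≢z ∘ sym) (replaceOne-sym replace)))

n≢1+n : ∀ {i} → i ≢ suc i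
n≢1+n i≡1+i = ℕP.1+n≢n (sym i≡1+i)

up⇒replaceOne : ∀ {n} i (ν la : Vec ℕ n) → Up i ν la → ReplaceOne i (suc i) ν la
up⇒replaceOne i ν la up with AnyP.tabulate⁻ up
... | k , νk≡i , same = update⇒replaceOne ν la k νk≡i same

replaceOne⇒up : ∀ {n} i (ν la : Vec ℕ n) → ReplaceOne i (suc i) ν la → Up i ν la
replaceOne⇒up i ν la replace with replaceOne⇒update ν la n≢1+n replace
... | k , νk≡i , same = AnyP.tabulate⁺ k (νk≡i , same)

down⇒replaceOne : ∀ {n} i (ν la : Vec ℕ n) → Down (suc i) ν la → ReplaceOne i (suc i) la ν
down⇒replaceOne i ν la down with AnyP.tabulate⁻ down
... | k , νk≡1+i , _ , same = replaceOne-sym (update⇒replaceOne ν la k νk≡1+i same)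

replaceOne⇒down : ∀ {n} i (ν la : Vec ℕ n) → ReplaceOne i (suc i) la ν → Down (suc i) ν la
replaceOne⇒down i ν la replace with replaceOne⇒update ν la (n≢1+n ∘ sym) (replaceOne-sym replace)
... | k , νk≡1+i , same = AnyP.tabulate⁺ k (νk≡1+i , s≤s z≤n , same)

¬down-0 : ∀ {n} (ν la : Vec ℕ n) → ¬ Down 0 ν la
¬down-0 ν la down with AnyP.tabulate⁻ down
... | _ , _ , () , _

ℚring : AlmostCommutativeRing 0ℓ 0ℓ
ℚring = fromCommutativeRing ℚP.+-*-commutativeRing (λ x → Dec.dec⇒maybe (0ℚ ℚP.≟ x))

ℕtoℚ≡mkℚ : ∀ k → ℕtoℚ k ≡ ℚ.mkℚ (ℤ.+ k) 0 (Coprime.sym (Coprime.1-coprimeTo k))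
ℕtoℚ≡mkℚ k = ℚP.normalize-coprime (Coprime.sym (Coprime.1-coprimeTo k))

ℕtoℚ-* : ∀ a b → ℕtoℚ (a ℕ.* b) ≡ ℕtoℚ a * ℕtoℚ b
ℕtoℚ-* a b rewrite ℕtoℚ≡mkℚ a | ℕtoℚ≡mkℚ b = cong (_/ 1) (ℤP.pos-* a b)

ℕtoℚ-nonneg : ∀ k → 0ℚ ℚ.≤ ℕtoℚ k
ℕtoℚ-nonneg k = ℚP.nonNegative⁻¹ (ℕtoℚ k) {{ℚP.normalize-nonNeg k 1}}

ℕtoℚ-pos : ∀ k → 1 ≤ k → 0ℚ ℚ.< ℕtoℚ k
ℕtoℚ-pos (suc k) _ = ℚP.positive⁻¹ (ℕtoℚ (suc k)) {{ℚP.normalize-pos (suc k) 1}}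

inv3n-pos : ∀ n → 1 ≤ n → 0ℚ ℚ.< inv3n n
inv3n-pos (suc k) _ = ℚP.positive⁻¹ _ {{ℚP.normalize-pos 1 (3 ℕ.* suc k)}}

inv3n-nonneg : ∀ n → 0ℚ ℚ.≤ inv3n n
inv3n-nonneg zero    = ℚP.≤-refl
inv3n-nonneg (suc k) = ℚP.<⇒≤ (inv3n-pos (suc k) (s≤s z≤n))

*-nonneg : ∀ {a b} → 0ℚ ℚ.≤ a → 0ℚ ℚ.≤ b → 0ℚ ℚ.≤ a * b
*-nonneg {a} {b} 0≤a 0≤b = ℚP.nonNegative⁻¹ _ {{ℚP.nonNeg*nonNeg⇒nonNeg a {{ℚ.nonNegative 0≤a}} b {{ℚ.nonNegative 0≤b}}}}

*-pos : ∀ {a b} → 0ℚ ℚ.< a → 0ℚ ℚ.< b → 0ℚ ℚ.< a * b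
*-pos {a} {b} 0<a 0<b = ℚP.positive⁻¹ _ {{ℚP.pos*pos⇒pos a {{ℚ.positive 0<a}} b {{ℚ.positive 0<b}}}}

^ℚ-pos : ∀ {u} → 0ℚ ℚ.< u → ∀ k → 0ℚ ℚ.< u ^ℚ k
^ℚ-pos 0<u zero    = ℚP.positive⁻¹ 1ℚ
^ℚ-pos 0<u (suc k) = *-pos 0<u (^ℚ-pos 0<u k)

pos*≡0⇒≡0 : ∀ {a b} → 0ℚ ℚ.< a → a * b ≡ 0ℚ → b ≡ 0ℚ
pos*≡0⇒≡0 {a} {b} 0<a ab≡0 = begin
  b                ≡⟨ ℚP.*-identityˡ b ⟨
  1ℚ * b           ≡⟨ cong (_* b) (ℚP.*-inverseˡ a) ⟨
  1/a * a * b      ≡⟨ ℚP.*-assoc 1/a a b ⟩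
  1/a * (a * b)    ≡⟨ cong (1/a *_) ab≡0 ⟩
  1/a * 0ℚ         ≡⟨ ℚP.*-zeroʳ 1/a ⟩
  0ℚ               ∎
  where
  open ≡-Reasoning
  instance a≢0 : ℚ.NonZero a
  a≢0 = ℚ.>-nonZero 0<a
  1/a = ℚ.1/ a

≤⇒0≤- : ∀ {a b} → b ℚ.≤ a → 0ℚ ℚ.≤ a - b
≤⇒0≤- {a} {b} b≤a = subst (ℚ._≤ a - b) (ℚP.+-inverseʳ b) (ℚP.+-monoˡ-≤ (ℚ.- b) b≤a)

+-nonneg : ∀ {a b} → 0ℚ ℚ.≤ a → 0ℚ ℚ.≤ b → 0ℚ ℚ.≤ a + b
+-nonneg 0≤a 0≤b = ℚP.+-mono-≤ 0≤a 0≤b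

pos-+-nonneg : ∀ {a b} → 0ℚ ℚ.< a → 0ℚ ℚ.≤ b → 0ℚ ℚ.< a + b
pos-+-nonneg 0<a 0≤b = ℚP.+-mono-<-≤ 0<a 0≤b

nonneg-+-pos : ∀ {a b} → 0ℚ ℚ.≤ a → 0ℚ ℚ.< b → 0ℚ ℚ.< a + b
nonneg-+-pos 0≤a 0<b = ℚP.+-mono-≤-< 0≤a 0<b

𝟙-nonneg : ∀ {P : Set} (P? : Dec P) → 0ℚ ℚ.≤ 𝟙 P?
𝟙-nonneg (yes _) = ℚP.<⇒≤ (ℚP.positive⁻¹ 1ℚ)
𝟙-nonneg (no _)  = ℚP.≤-refl

𝟙*-pos : ∀ {P : Set} (P? : Dec P) {x} → P → 0ℚ ℚ.< x → 0ℚ ℚ.< 𝟙 P? * x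
𝟙*-pos (yes _) {x} _  0<x = subst (0ℚ ℚ.<_) (sym (ℚP.*-identityˡ x)) 0<x
𝟙*-pos (no ¬p)     p  _   = ⊥-elim (¬p p)

𝟙*-reject : ∀ {P : Set} (P? : Dec P) x → ¬ P → 𝟙 P? * x ≡ 0ℚ
𝟙*-reject (yes p) x ¬p = ⊥-elim (¬p p)
𝟙*-reject (no _)  x _  = ℚP.*-zeroˡ x

𝟙*-cong : ∀ {P Q : Set} (P? : Dec P) (Q? : Dec Q) x y → (P → Q) → (Q → P) → (P → x ≡ y) → 𝟙 P? * x ≡ 𝟙 Q? * y
𝟙*-cong (yes p) (yes _) x y _   _   x≡y = cong (1ℚ *_) (x≡y p)
𝟙*-cong (yes p) (no ¬q) x y P⇒Q _   _   = ⊥-elim (¬q (P⇒Q p))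
𝟙*-cong (no ¬p) (yes q) x y _   Q⇒P _   = ⊥-elim (¬p (Q⇒P q))
𝟙*-cong (no _)  (no _)  x y _   _   _   = trans (ℚP.*-zeroˡ x) (sym (ℚP.*-zeroˡ y))

Σℚ-applyUpTo : ∀ (g : ℕ → ℕ) V (f : ℕ → ℚ) → Σℚ (applyUpTo g V) f ≡ ∑ℚ< V (f ∘ g)
Σℚ-applyUpTo g zero    f = refl
Σℚ-applyUpTo g (suc V) f = cong (f (g 0) +_) (Σℚ-applyUpTo (g ∘ suc) V f)

∑ℚ<-*ˡ : ∀ V K f → ∑ℚ< V (λ j → K * f j) ≡ K * ∑ℚ< V f
∑ℚ<-*ˡ zero    K f = sym (ℚP.*-zeroʳ K)
∑ℚ<-*ˡ (suc V) K f rewrite ∑ℚ<-*ˡ V K (f ∘ suc) = sym (ℚP.*-distribˡ-+ K (f 0) _)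

∑ℚ<-nonneg : ∀ V f → (∀ j → 0ℚ ℚ.≤ f j) → 0ℚ ℚ.≤ ∑ℚ< V f
∑ℚ<-nonneg zero    f 0≤f = ℚP.≤-refl
∑ℚ<-nonneg (suc V) f 0≤f = +-nonneg (0≤f 0) (∑ℚ<-nonneg V (f ∘ suc) (0≤f ∘ suc))

∑ℚ<-pos : ∀ V f i → (∀ j → 0ℚ ℚ.≤ f j) → i < V → 0ℚ ℚ.< f i → 0ℚ ℚ.< ∑ℚ< V f
∑ℚ<-pos (suc V) f zero    0≤f _         0<fi = pos-+-nonneg 0<fi (∑ℚ<-nonneg V (f ∘ suc) (0≤f ∘ suc))
∑ℚ<-pos (suc V) f (suc i) 0≤f (s≤s i<V) 0<fi = nonneg-+-pos (0≤f 0) (∑ℚ<-pos V (f ∘ suc) i (0≤f ∘ suc) i<V 0<fi)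

Σℚ-cong : ∀ {A : Set} (xs : List A) {f g : A → ℚ} → All (λ x → f x ≡ g x) xs → Σℚ xs f ≡ Σℚ xs g
Σℚ-cong []       _              = refl
Σℚ-cong (x ∷ xs) (fx≡gx ∷ rest) = cong₂ _+_ fx≡gx (Σℚ-cong xs rest)

Σℚ-*ˡ : ∀ {A : Set} (xs : List A) K f → Σℚ xs (λ x → K * f x) ≡ K * Σℚ xs f
Σℚ-*ˡ []       K f = sym (ℚP.*-zeroʳ K)
Σℚ-*ˡ (x ∷ xs) K f rewrite Σℚ-*ˡ xs K f = sym (ℚP.*-distribˡ-+ K (f x) _)

Σℚ-- : ∀ {A : Set} (xs : List A) f g → Σℚ xs (λ x → f x - g x) ≡ Σℚ xs f - Σℚ xs g
Σℚ-- []       f g = refl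
Σℚ-- (x ∷ xs) f g rewrite Σℚ-- xs f g = regroup (f x) (g x) (Σℚ xs f) (Σℚ xs g)
  where
  regroup : ∀ a b c d → (a - b) + (c - d) ≡ (a + c) - (b + d)
  regroup = solve-∀ ℚring

Σℚ-partition : ∀ {A : Set} {p} {P : Pred A p} (P? : Decidable P) xs f →
               Σℚ xs f ≡ Σℚ (filter P? xs) f + Σℚ (filter (¬? ∘ P?) xs) f
Σℚ-partition P? []       f = sym (ℚP.+-identityˡ 0ℚ)
Σℚ-partition P? (x ∷ xs) f with P? x
... | yes _ = trans (cong (f x +_) (Σℚ-partition P? xs f)) (sym (ℚP.+-assoc (f x) _ _))
... | no _  = trans (cong (f x +_) (Σℚ-partition P? xs f))
                    (ℚ+.x∙yz≈y∙xz (f x) (Σℚ (filter P? xs) f) (Σℚ (filter (¬? ∘ P?) xs) f))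

Σℚ-nonneg : ∀ {A : Set} (xs : List A) f → All (λ x → 0ℚ ℚ.≤ f x) xs → 0ℚ ℚ.≤ Σℚ xs f
Σℚ-nonneg []       f _            = ℚP.≤-refl
Σℚ-nonneg (x ∷ xs) f (0≤fx ∷ rest) = +-nonneg 0≤fx (Σℚ-nonneg xs f rest)

Σℚ-nonneg-≡0 : ∀ {A : Set} (xs : List A) f → All (λ x → 0ℚ ℚ.≤ f x) xs → Σℚ xs f ≡ 0ℚ → All (λ x → f x ≡ 0ℚ) xs
Σℚ-nonneg-≡0 []       f _             _   = []
Σℚ-nonneg-≡0 (x ∷ xs) f (0≤fx ∷ rest) Σ≡0 =
  fx≡0 ∷ Σℚ-nonneg-≡0 xs f rest (trans (sym (ℚP.+-identityˡ _)) (trans (cong (_+ Σℚ xs f) (sym fx≡0)) Σ≡0))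
  where
  fx≤Σ : f x ℚ.≤ f x + Σℚ xs f
  fx≤Σ = subst (ℚ._≤ f x + Σℚ xs f) (ℚP.+-identityʳ (f x)) (ℚP.+-monoʳ-≤ (f x) (Σℚ-nonneg xs f rest))
  fx≡0 : f x ≡ 0ℚ
  fx≡0 = ℚP.≤-antisym (subst (f x ℚ.≤_) Σ≡0 fx≤Σ) 0≤fx

-- Lowering parts to a single column

lower : ∀ {n} → Vec ℕ n → Fin n → Vec ℕ n
lower v k = v [ k ]≔ (lookup v k ∸ 1)

data Lowerable {n} (v : Vec ℕ n) : Set where
  flat    : All (_≤ 1) (toList v) → Lowerable v
  lowerAt : ∀ k → 2 ≤ lookup v k → (NonIncreasing v → NonIncreasing (lower v k)) → Lowerable v

-- Lowering the last part that is at least 2 keeps the tuple nonincreasing.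
lowerable : ∀ {n} (v : Vec ℕ n) → Lowerable v
lowerable []      = flat []
lowerable (x ∷ v) with lowerable v
... | lowerAt k 2≤vk keeps = lowerAt (fsuc k) 2≤vk λ dec → behind v k dec (keeps (Linked.tail dec))
  where
  behind : ∀ {m} (w : Vec ℕ m) k → NonIncreasing (x ∷ w) → NonIncreasing (lower w k) → NonIncreasing (x ∷ lower w k)
  behind (y ∷ w) fzero    dec dec′ = ℕP.≤-trans (ℕP.m∸n≤m y 1) (Linked.head dec) Linked.∷ dec′
  behind (y ∷ w) (fsuc k) dec dec′ = Linked.head dec Linked.∷ dec′
... | flat v≤1 with 2 ℕP.≤? x
...   | no x≱2  = flat (ℕP.≤-pred (ℕP.≰⇒> x≱2) ∷ v≤1)
...   | yes 2≤x = lowerAt fzero 2≤x (before v v≤1 ∘ Linked.tail)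
  where
  before : ∀ {m} (w : Vec ℕ m) → All (_≤ 1) (toList w) → NonIncreasing w → NonIncreasing ((x ∸ 1) ∷ w)
  before []      _            _   = Linked.[-]
  before (y ∷ w) (y≤1 ∷ _)   dec = ℕP.≤-trans y≤1 (ℕP.∸-monoˡ-≤ 1 2≤x) Linked.∷ dec

size-lower : ∀ {n} (v : Vec ℕ n) k → 1 ≤ lookup v k → size (lower v k) < size v
size-lower (suc x ∷ v) fzero    _     = ℕP.+-monoˡ-< (size v) (ℕP.n<1+n x)
size-lower (x ∷ v)     (fsuc k) 1≤vk = ℕP.+-monoʳ-< x (size-lower v k 1≤vk)

lower-≢ : ∀ {n} (v : Vec ℕ n) k → 1 ≤ lookup v k → lower v k ≢ v
lower-≢ v k 1≤vk lower≡v = ℕP.<-irrefl (cong size lower≡v) (size-lower v k 1≤vk)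

len-update : ∀ {n} (v : Vec ℕ n) k z → 1 ≤ lookup v k → 1 ≤ z → len (v [ k ]≔ z) ≡ len v
len-update (suc x ∷ v) fzero    (suc z) _    _   = refl
len-update (zero ∷ v)  (fsuc k) z       1≤vk 1≤z = len-update v k z 1≤vk 1≤z
len-update (suc x ∷ v) (fsuc k) z       1≤vk 1≤z = cong suc (len-update v k z 1≤vk 1≤z)

bounded-update : ∀ {n p} (v : Vec ℕ n) k z → All (_≤ p) (toList v) → z ≤ p → All (_≤ p) (toList (v [ k ]≔ z))
bounded-update (x ∷ v) fzero    z (_ ∷ v≤p)   z≤p = z≤p ∷ v≤p
bounded-update (x ∷ v) (fsuc k) z (x≤p ∷ v≤p) z≤p = x≤p ∷ bounded-update v k z v≤p z≤p

chi-lower : ∀ {n p q} (v : Vec ℕ n) k → Chi n p q v → 2 ≤ lookup v k →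
            (NonIncreasing v → NonIncreasing (lower v k)) → Chi n p q (lower v k)
chi-lower v k (dec , v≤p , len≡q) 2≤vk keeps =
  keeps dec ,
  bounded-update v k _ v≤p (ℕP.≤-trans (ℕP.m∸n≤m _ 1) (All.lookup v≤p (lookup∈toList v k))) ,
  trans (len-update v k _ (ℕP.≤-trans (s≤s z≤n) 2≤vk) (ℕP.∸-monoˡ-≤ 1 2≤vk)) len≡q

column : (n k : ℕ) → Vec ℕ n
column zero    k       = []
column (suc n) zero    = 0 ∷ column n 0
column (suc n) (suc k) = 1 ∷ column n k

len-column-0 : ∀ n → len (column n 0) ≡ 0
len-column-0 zero    = refl
len-column-0 (suc n) = len-column-0 n

zeros-after-0 : ∀ {n} (w : Vec ℕ n) → NonIncreasing (0 ∷ w) → w ≡ column n 0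
zeros-after-0 []           _               = refl
zeros-after-0 (zero ∷ w)   (z≤n Linked.∷ dec) = cong (0 ∷_) (zeros-after-0 w dec)

flat⇒column : ∀ {n} (v : Vec ℕ n) → NonIncreasing v → All (_≤ 1) (toList v) → v ≡ column n (len v)
flat⇒column []                 _   _           = refl
flat⇒column {suc n} (0 ∷ w)    dec _           rewrite zeros-after-0 w dec | len-column-0 n = refl
flat⇒column (1 ∷ w)            dec (_ ∷ w≤1) = cong (1 ∷_) (flat⇒column w (Linked.tail dec) w≤1)
flat⇒column (suc (suc _) ∷ w)  _   (s≤s () ∷ _)

-- Detailed balance

replaceOne-size-suc : ∀ {n i} {a b : Vec ℕ n} → ReplaceOne i (suc i) a b → size b ≡ suc (size a)
replaceOne-size-suc {i = i} {a} {b} replace =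
  ℕP.+-cancelʳ-≡ i _ _ (trans (replaceOne-size n≢1+n replace) (ℕP.+-suc (size a) i))

module GrowthRates (n p : ℕ) (u : ℚ) where

  rate : Vec ℕ n → Vec ℕ n → ℚ
  rate = offDiag n p u

  weight : Vec ℕ n → ℚ
  weight v = ℕtoℚ (numRearr v) * u ^ℚ size v

  upRate : Vec ℕ n → Vec ℕ n → ℕ → ℚ
  upRate ν la i = 𝟙 (up? i ν la) * (ℕtoℚ (mult i ν) * u * inv3n n)

  downRate : Vec ℕ n → Vec ℕ n → ℕ → ℚ
  downRate ν la i = 𝟙 (down? i ν la) * (ℕtoℚ (mult i ν) * inv3n n)

  rate-split : ∀ ν la → rate ν la ≡ ∑ℚ< (suc p) (upRate ν la) + ∑ℚ< (suc p) (downRate ν la)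
  rate-split ν la = trans (Σℚ-applyUpTo id (suc p) (λ i → upRate ν la i + downRate ν la i))
                          (Sumℚ.fold<-∙ (suc p) (upRate ν la) (downRate ν la))

  weight-raise : ∀ {i} {ν la : Vec ℕ n} → ReplaceOne i (suc i) ν la →
                 weight ν * (ℕtoℚ (mult i ν) * u) ≡ weight la * ℕtoℚ (mult (suc i) la)
  weight-raise {i} {ν} {la} replace = begin
    ℕtoℚ (numRearr ν) * u ^ℚ size ν * (ℕtoℚ (mult i ν) * u)
      ≡⟨ regroup (ℕtoℚ (numRearr ν)) (u ^ℚ size ν) (ℕtoℚ (mult i ν)) u ⟩
    ℕtoℚ (numRearr ν) * ℕtoℚ (mult i ν) * u ^ℚ suc (size ν)
      ≡⟨ cong₂ _*_ (sym (ℕtoℚ-* (numRearr ν) (mult i ν))) (cong (u ^ℚ_) (sym (replaceOne-size-suc replace))) ⟩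
    ℕtoℚ (numRearr ν ℕ.* mult i ν) * u ^ℚ size la
      ≡⟨ cong (λ k → ℕtoℚ k * u ^ℚ size la) (numRearr-replaceOne n≢1+n replace) ⟩
    ℕtoℚ (numRearr la ℕ.* mult (suc i) la) * u ^ℚ size la
      ≡⟨ cong (_* u ^ℚ size la) (ℕtoℚ-* (numRearr la) (mult (suc i) la)) ⟩
    ℕtoℚ (numRearr la) * ℕtoℚ (mult (suc i) la) * u ^ℚ size la
      ≡⟨ regroup′ (ℕtoℚ (numRearr la)) (ℕtoℚ (mult (suc i) la)) (u ^ℚ size la) ⟩
    ℕtoℚ (numRearr la) * u ^ℚ size la * ℕtoℚ (mult (suc i) la)
      ∎
    where
    open ≡-Reasoning
    regroup : ∀ N U m x → N * U * (m * x) ≡ N * m * (x * U)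
    regroup = solve-∀ ℚring
    regroup′ : ∀ N m U → N * m * U ≡ N * U * m
    regroup′ = solve-∀ ℚring

  up-down-balance : ∀ ν la i → weight ν * upRate ν la i ≡ weight la * downRate la ν (suc i)
  up-down-balance ν la i = begin
    weight ν * upRate ν la i
      ≡⟨ pull (weight ν) (𝟙 (up? i ν la)) (ℕtoℚ (mult i ν) * u) (inv3n n) ⟩
    𝟙 (up? i ν la) * (weight ν * (ℕtoℚ (mult i ν) * u) * inv3n n)
      ≡⟨ 𝟙*-cong (up? i ν la) (down? (suc i) la ν) _ _
           (replaceOne⇒down i la ν ∘ up⇒replaceOne i ν la)
           (replaceOne⇒up i ν la ∘ down⇒replaceOne i la ν)
           (λ up → cong (_* inv3n n) (weight-raise (up⇒replaceOne i ν la up))) ⟩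
    𝟙 (down? (suc i) la ν) * (weight la * ℕtoℚ (mult (suc i) la) * inv3n n)
      ≡⟨ pull (weight la) (𝟙 (down? (suc i) la ν)) (ℕtoℚ (mult (suc i) la)) (inv3n n) ⟨
    weight la * downRate la ν (suc i)
      ∎
    where
    open ≡-Reasoning
    pull : ∀ w e m c → w * (e * (m * c)) ≡ e * (w * m * c)
    pull = solve-∀ ℚring

  ¬up-beyond : ∀ {ν la : Vec ℕ n} → All (_≤ p) (toList la) → ¬ Up p ν la
  ¬up-beyond {ν} {la} la≤p up = ℕP.1+n≰n (All.lookup la≤p (occurrences>0⇒∈ (suc p) (toList la)
    (≡1+⇒1≤ (replaceOne-at-z n≢1+n (up⇒replaceOne p ν la up)))))

  up-down-balance-∑ : ∀ ν la → All (_≤ p) (toList la) →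
                      weight ν * ∑ℚ< (suc p) (upRate ν la) ≡ weight la * ∑ℚ< (suc p) (downRate la ν)
  up-down-balance-∑ ν la la≤p = begin
    weight ν * ∑ℚ< (suc p) (upRate ν la)
      ≡⟨ ∑ℚ<-*ˡ (suc p) (weight ν) (upRate ν la) ⟨
    ∑ℚ< (suc p) (λ i → weight ν * upRate ν la i)
      ≡⟨ Sumℚ.fold<-shift p (λ i → weight la * downRate la ν i) (λ i → weight ν * upRate ν la i)
                            down-0 up-p (up-down-balance ν la) ⟩
    ∑ℚ< (suc p) (λ i → weight la * downRate la ν i)
      ≡⟨ ∑ℚ<-*ˡ (suc p) (weight la) (downRate la ν) ⟩
    weight la * ∑ℚ< (suc p) (downRate la ν)
      ∎
    where
    open ≡-Reasoning
    down-0 : weight la * downRate la ν 0 ≡ 0ℚ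
    down-0 = trans (cong (weight la *_) (𝟙*-reject (down? 0 la ν) _ (¬down-0 la ν))) (ℚP.*-zeroʳ (weight la))
    up-p : weight ν * upRate ν la p ≡ 0ℚ
    up-p = trans (cong (weight ν *_) (𝟙*-reject (up? p ν la) _ (¬up-beyond {ν} la≤p))) (ℚP.*-zeroʳ (weight ν))

  detailed-balance : ∀ ν la → All (_≤ p) (toList ν) → All (_≤ p) (toList la) →
                     weight ν * rate ν la ≡ weight la * rate la ν
  detailed-balance ν la ν≤p la≤p = begin
    weight ν * rate ν la
      ≡⟨ trans (cong (weight ν *_) (rate-split ν la)) (ℚP.*-distribˡ-+ (weight ν) _ _) ⟩
    weight ν * ∑ℚ< (suc p) (upRate ν la) + weight ν * ∑ℚ< (suc p) (downRate ν la)
      ≡⟨ cong₂ _+_ (up-down-balance-∑ ν la la≤p) (sym (up-down-balance-∑ la ν ν≤p)) ⟩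
    weight la * ∑ℚ< (suc p) (downRate la ν) + weight la * ∑ℚ< (suc p) (upRate la ν)
      ≡⟨ ℚP.+-comm (weight la * ∑ℚ< (suc p) (downRate la ν)) _ ⟩
    weight la * ∑ℚ< (suc p) (upRate la ν) + weight la * ∑ℚ< (suc p) (downRate la ν)
      ≡⟨ trans (sym (ℚP.*-distribˡ-+ (weight la) _ _)) (cong (weight la *_) (sym (rate-split la ν))) ⟩
    weight la * rate la ν
      ∎
    where open ≡-Reasoning

  upRate-nonneg : 0ℚ ℚ.≤ u → ∀ ν la i → 0ℚ ℚ.≤ upRate ν la i
  upRate-nonneg 0≤u ν la i =
    *-nonneg (𝟙-nonneg (up? i ν la)) (*-nonneg (*-nonneg (ℕtoℚ-nonneg (mult i ν)) 0≤u) (inv3n-nonneg n))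

  downRate-nonneg : ∀ ν la i → 0ℚ ℚ.≤ downRate ν la i
  downRate-nonneg ν la i = *-nonneg (𝟙-nonneg (down? i ν la)) (*-nonneg (ℕtoℚ-nonneg (mult i ν)) (inv3n-nonneg n))

  rate-nonneg : 0ℚ ℚ.≤ u → ∀ ν la → 0ℚ ℚ.≤ rate ν la
  rate-nonneg 0≤u ν la = subst (0ℚ ℚ.≤_) (sym (rate-split ν la))
    (+-nonneg (∑ℚ<-nonneg (suc p) _ (upRate-nonneg 0≤u ν la)) (∑ℚ<-nonneg (suc p) _ (downRate-nonneg ν la)))

  rate-lower-pos : 0ℚ ℚ.< u → 1 ≤ n → ∀ v k → All (_≤ p) (toList v) → 1 ≤ lookup v k → 0ℚ ℚ.< rate v (lower v k)
  rate-lower-pos 0<u 1≤n v k v≤p 1≤vk = subst (0ℚ ℚ.<_) (sym (rate-split v w))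
    (nonneg-+-pos (∑ℚ<-nonneg (suc p) _ (upRate-nonneg (ℚP.<⇒≤ 0<u) v w))
                  (∑ℚ<-pos (suc p) _ i (downRate-nonneg v w) (s≤s (All.lookup v≤p (lookup∈toList v k))) down-pos))
    where
    w = lower v k
    i = lookup v k
    lowered : Down i v w
    lowered = AnyP.tabulate⁺ k (refl , 1≤vk , sameMultiset-refl (toList w))
    down-pos : 0ℚ ℚ.< downRate v w i
    down-pos = 𝟙*-pos (down? i v w) lowered
      (*-pos (ℕtoℚ-pos (mult i v) (∈⇒occurrences>0 i (toList v) (lookup∈toList v k))) (inv3n-pos n 1≤n))

  rate-raise-pos : 0ℚ ℚ.< u → 1 ≤ n → ∀ v k → All (_≤ p) (toList v) → 1 ≤ lookup v k → 0ℚ ℚ.< rate (lower v k) v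
  rate-raise-pos 0<u 1≤n v k v≤p 1≤vk = subst (0ℚ ℚ.<_) (sym (rate-split w v))
    (pos-+-nonneg (∑ℚ<-pos (suc p) _ i (upRate-nonneg (ℚP.<⇒≤ 0<u) w v) i<1+p up-pos)
                  (∑ℚ<-nonneg (suc p) _ (downRate-nonneg w v)))
    where
    w = lower v k
    i = lookup v k ∸ 1
    i<1+p : i < suc p
    i<1+p = s≤s (ℕP.≤-trans (ℕP.m∸n≤m _ 1) (All.lookup v≤p (lookup∈toList v k)))
    wk≡i : lookup w k ≡ i
    wk≡i = VecP.lookup∘update k v i
    raise-lower : w [ k ]≔ suc i ≡ v
    raise-lower = trans (VecP.[]≔-idempotent v k) (trans (cong (v [ k ]≔_) (ℕP.m+[n∸m]≡n 1≤vk)) (VecP.[]≔-lookup v k))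
    raised : Up i w v
    raised = AnyP.tabulate⁺ k (wk≡i ,
      subst (λ x → SameMultiset (toList v) (toList x)) (sym raise-lower) (sameMultiset-refl (toList v)))
    up-pos : 0ℚ ℚ.< upRate w v i
    up-pos = 𝟙*-pos (up? i w v) raised
      (*-pos (*-pos (ℕtoℚ-pos (mult i w) (∈⇒occurrences>0 i (toList w) (subst (_∈ toList w) wk≡i (lookup∈toList w k)))) 0<u)
             (inv3n-pos n 1≤n))

_≡?_ : ∀ {n} → DecidableEquality (Vec ℕ n)
_≡?_ = VecP.≡-dec _≟_

tuples-multiplicity : ∀ n p (v : Vec ℕ n) → All (_≤ p) (toList v) → length (filter (_≡? v) (tuples n p)) ≡ 1
tuples-multiplicity zero    p []      _          = refl
tuples-multiplicity (suc n) p (y ∷ v) (y≤p ∷ v≤p) =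
  trans (length-filter-concatMap (_≡? (y ∷ v)) (λ x → map (x ∷_) (tuples n p)) id (suc p))
        (trans (Sum.fold<-update (suc p) y {h = λ _ → 0} 1 (s≤s y≤p) elsewhere at-y)
               (cong suc (Sum.fold<-ε (suc p) _ (λ _ _ → refl))))
  where
  copiesStartingWith : ℕ → ℕ
  copiesStartingWith x = length (filter (_≡? (y ∷ v)) (map (x ∷_) (tuples n p)))
  elsewhere : ∀ x → x ≢ y → copiesStartingWith x ≡ 0
  elsewhere x x≢y = trans (length-filter-map (_≡? (y ∷ v)) (x ∷_) (tuples n p))
    (cong length (ListP.filter-none ((_≡? (y ∷ v)) ∘ (x ∷_)) {xs = tuples n p} (All.tabulate λ _ → x≢y ∘ VecP.∷-injectiveˡ)))
  at-y : copiesStartingWith y ≡ 1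
  at-y = trans (length-filter-map (_≡? (y ∷ v)) (y ∷_) (tuples n p))
    (trans (cong length (ListP.filter-≐ _ (_≡? v) (VecP.∷-injectiveʳ , cong (y ∷_)) (tuples n p)))
           (tuples-multiplicity n p v v≤p))

length-filter-filter : ∀ {A : Set} {p q} {P : Pred A p} {Q : Pred A q} (P? : Decidable P) (Q? : Decidable Q) xs →
                       (∀ {x} → P x → Q x) → length (filter P? (filter Q? xs)) ≡ length (filter P? xs)
length-filter-filter P? Q? [] _ = refl
length-filter-filter P? Q? (x ∷ xs) P⇒Q with Q? x
... | yes _ with P? x
...   | yes _ = cong suc (length-filter-filter P? Q? xs P⇒Q)
...   | no _  = length-filter-filter P? Q? xs P⇒Q
length-filter-filter P? Q? (x ∷ xs) P⇒Q | no ¬qx with P? x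
...   | yes px = ⊥-elim (¬qx (P⇒Q px))
...   | no _   = length-filter-filter P? Q? xs P⇒Q

chi-bounded : ∀ {n p q} {v : Vec ℕ n} → Chi n p q v → All (_≤ p) (toList v)
chi-bounded (_ , bounded , _) = bounded

chi⇒∈chiList : ∀ {n p q} {la : Vec ℕ n} → Chi n p q la → la ∈ chiList n p q
chi⇒∈chiList {n} {p} {q} {la} chi = ∈P.∈-filter⁺ (chi? n p q) (tuples-∈ n p la (chi-bounded chi)) chi
  where
  tuples-∈ : ∀ n p (v : Vec ℕ n) → All (_≤ p) (toList v) → v ∈ tuples n p
  tuples-∈ zero    p []      _          = here refl
  tuples-∈ (suc n) p (y ∷ v) (y≤p ∷ v≤p) =
    ∈P.∈-concat⁺′ (∈P.∈-map⁺ (y ∷_) (tuples-∈ n p v v≤p))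
                  (∈P.∈-map⁺ (λ x → map (x ∷_) (tuples n p)) (∈P.∈-upTo⁺ (s≤s y≤p)))

∈chiList⇒chi : ∀ {n p q} {la : Vec ℕ n} → la ∈ chiList n p q → Chi n p q la
∈chiList⇒chi {n} {p} {q} la∈ = proj₂ (∈P.∈-filter⁻ (chi? n p q) {xs = tuples n p} la∈)

filter-≡-chiList : ∀ {n p q} {la : Vec ℕ n} → Chi n p q la → filter (_≡? la) (chiList n p q) ≡ la ∷ []
filter-≡-chiList {n} {p} {q} {la} chi = singleton (AllP.all-filter (_≡? la) (chiList n p q))
  (trans (length-filter-filter (_≡? la) (chi? n p q) (tuples n p) (λ x≡la → subst (Chi n p q) (sym x≡la) chi))
         (tuples-multiplicity n p la (chi-bounded chi)))
  where
  singleton : ∀ {xs : List (Vec ℕ n)} → All (_≡ la) xs → length xs ≡ 1 → xs ≡ la ∷ []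
  singleton (x≡la ∷ []) _ = cong (_∷ []) x≡la

d-diag : ∀ n p q u (la : Vec ℕ n) →
         d n p q u la la ≡ 1ℚ - Σℚ (filter (λ la′ → ¬? (la′ ≡? la)) (chiList n p q)) (offDiag n p u la)
d-diag n p q u la with la ≡? la
... | yes _     = refl
... | no la≢la  = ⊥-elim (la≢la refl)

d-off : ∀ n p q u (ν la : Vec ℕ n) → ν ≢ la → d n p q u ν la ≡ offDiag n p u ν la
d-off n p q u ν la ν≢la with la ≡? ν
... | yes la≡ν = ⊥-elim (ν≢la (sym la≡ν))
... | no _     = refl

module Harmonic (n p q : ℕ) (u : ℚ) (0<u : 0ℚ ℚ.< u) (π : Vec ℕ n → ℚ) (stationary : IsStationary n p q u π) where
  open GrowthRates n p u

  χ : List (Vec ℕ n)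
  χ = chiList n p q

  others : Vec ℕ n → List (Vec ℕ n)
  others la = filter (λ la′ → ¬? (la′ ≡? la)) χ

  ∈others⇒chi : ∀ {la ν} → ν ∈ others la → Chi n p q ν × ν ≢ la
  ∈others⇒chi {la} ν∈ =
    let ν∈χ , ν≢la = ∈P.∈-filter⁻ (λ la′ → ¬? (la′ ≡? la)) {xs = χ} ν∈ in ∈chiList⇒chi ν∈χ , ν≢la

  weight-pos : ∀ v → 0ℚ ℚ.< weight v
  weight-pos v = *-pos (ℕtoℚ-pos _ (numRearr>0 v)) (^ℚ-pos 0<u (size v))

  -- Opaque: h is used only through π≡h*weight.
  opaque
    h : Vec ℕ n → ℚ
    h v = π v * (ℚ.1/ weight v) {{ℚ.>-nonZero (weight-pos v)}}

    π≡h*weight : ∀ v → π v ≡ h v * weight v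
    π≡h*weight v = sym (trans (ℚP.*-assoc (π v) _ (weight v))
      (trans (cong (π v *_) (ℚP.*-inverseˡ (weight v) {{ℚ.>-nonZero (weight-pos v)}})) (ℚP.*-identityʳ (π v))))

  global-balance : ∀ {la} → Chi n p q la → π la * Σℚ (others la) (rate la) ≡ Σℚ (others la) (λ ν → π ν * rate ν la)
  global-balance {la} chi = solve-for-T (begin
    π la
      ≡⟨ proj₂ (proj₂ stationary) la chi ⟩
    Σℚ χ inflow
      ≡⟨ Σℚ-partition (_≡? la) χ inflow ⟩
    Σℚ (filter (_≡? la) χ) inflow + Σℚ (others la) inflow
      ≡⟨ cong₂ _+_ self (Σℚ-cong (others la) (All.tabulate from-others)) ⟩
    π la * (1ℚ - Σℚ (others la) (rate la)) + Σℚ (others la) (λ ν → π ν * rate ν la)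
      ∎)
    where
    open ≡-Reasoning
    inflow : Vec ℕ n → ℚ
    inflow ν = π ν * d n p q u ν la
    self : Σℚ (filter (_≡? la) χ) inflow ≡ π la * (1ℚ - Σℚ (others la) (rate la))
    self = trans (cong (λ xs → Σℚ xs inflow) (filter-≡-chiList chi))
                 (trans (ℚP.+-identityʳ _) (cong (π la *_) (d-diag n p q u la)))
    from-others : ∀ {ν} → ν ∈ others la → inflow ν ≡ π ν * rate ν la
    from-others ν∈ = cong (π _ *_) (d-off n p q u _ la (proj₂ (∈others⇒chi ν∈)))
    solve-for-T : ∀ {P S T} → P ≡ P * (1ℚ - S) + T → P * S ≡ T
    solve-for-T {P} {S} {T} P≡ = begin
      P * S                              ≡⟨ lhs P S ⟩
      P - P * (1ℚ - S)                   ≡⟨ cong (λ x → x - P * (1ℚ - S)) P≡ ⟩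
      P * (1ℚ - S) + T - P * (1ℚ - S)    ≡⟨ rhs (P * (1ℚ - S)) T ⟩
      T                                  ∎
      where
      lhs : ∀ P S → P * S ≡ P - P * (1ℚ - S)
      lhs = solve-∀ ℚring
      rhs : ∀ X T → X + T - X ≡ T
      rhs = solve-∀ ℚring

  weighted-outflow : ∀ la → weight la * Σℚ (others la) (λ ν → h la * rate la ν) ≡ π la * Σℚ (others la) (rate la)
  weighted-outflow la = begin
    weight la * Σℚ (others la) (λ ν → h la * rate la ν)
      ≡⟨ cong (weight la *_) (Σℚ-*ˡ (others la) (h la) (rate la)) ⟩
    weight la * (h la * Σℚ (others la) (rate la))
      ≡⟨ ℚ*.x∙yz≈y∙xz (weight la) (h la) (Σℚ (others la) (rate la)) ⟩
    h la * (weight la * Σℚ (others la) (rate la))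
      ≡⟨ ℚP.*-assoc (h la) (weight la) (Σℚ (others la) (rate la)) ⟨
    h la * weight la * Σℚ (others la) (rate la)
      ≡⟨ cong (_* Σℚ (others la) (rate la)) (π≡h*weight la) ⟨
    π la * Σℚ (others la) (rate la)
      ∎
    where open ≡-Reasoning

  weighted-inflow : ∀ {la} → Chi n p q la →
                    weight la * Σℚ (others la) (λ ν → h ν * rate la ν) ≡ Σℚ (others la) (λ ν → π ν * rate ν la)
  weighted-inflow {la} chi =
    trans (sym (Σℚ-*ˡ (others la) (weight la) (λ ν → h ν * rate la ν))) (Σℚ-cong (others la) (All.tabulate balanced))
    where
    open ≡-Reasoning
    balanced : ∀ {ν} → ν ∈ others la → weight la * (h ν * rate la ν) ≡ π ν * rate ν la
    balanced {ν} ν∈ = begin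
      weight la * (h ν * rate la ν)
        ≡⟨ ℚ*.x∙yz≈y∙xz (weight la) (h ν) (rate la ν) ⟩
      h ν * (weight la * rate la ν)
        ≡⟨ cong (h ν *_) (detailed-balance ν la (chi-bounded (proj₁ (∈others⇒chi ν∈))) (chi-bounded chi)) ⟨
      h ν * (weight ν * rate ν la)
        ≡⟨ ℚP.*-assoc (h ν) (weight ν) (rate ν la) ⟨
      h ν * weight ν * rate ν la
        ≡⟨ cong (_* rate ν la) (π≡h*weight ν) ⟨
      π ν * rate ν la
        ∎

  harmonic : ∀ {la} → Chi n p q la → Σℚ (others la) (λ ν → rate la ν * (h la - h ν)) ≡ 0ℚ
  harmonic {la} chi = pos*≡0⇒≡0 (weight-pos la) (begin
    weight la * Σℚ (others la) (λ ν → rate la ν * (h la - h ν))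
      ≡⟨ cong (weight la *_) (trans (Σℚ-cong (others la) (All.tabulate λ {ν} _ → expand (rate la ν) (h la) (h ν)))
                                    (Σℚ-- (others la) (λ ν → h la * rate la ν) (λ ν → h ν * rate la ν))) ⟩
    weight la * (Σℚ (others la) (λ ν → h la * rate la ν) - Σℚ (others la) (λ ν → h ν * rate la ν))
      ≡⟨ *-distribˡ-- (weight la) _ _ ⟩
    weight la * Σℚ (others la) (λ ν → h la * rate la ν) - weight la * Σℚ (others la) (λ ν → h ν * rate la ν)
      ≡⟨ cong₂ _-_ (weighted-outflow la) (weighted-inflow chi) ⟩
    π la * Σℚ (others la) (rate la) - Σℚ (others la) (λ ν → π ν * rate ν la)
      ≡⟨ cong (_- Σℚ (others la) (λ ν → π ν * rate ν la)) (global-balance chi) ⟩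
    Σℚ (others la) (λ ν → π ν * rate ν la) - Σℚ (others la) (λ ν → π ν * rate ν la)
      ≡⟨ ℚP.+-inverseʳ (Σℚ (others la) (λ ν → π ν * rate ν la)) ⟩
    0ℚ
      ∎)
    where
    open ≡-Reasoning
    expand : ∀ o a b → o * (a - b) ≡ a * o - b * o
    expand = solve-∀ ℚring
    *-distribˡ-- : ∀ w a b → w * (a - b) ≡ w * a - w * b
    *-distribˡ-- = solve-∀ ℚring

-- The maximum principle

module Constancy (n p q : ℕ) (1≤n : 1 ≤ n) (u : ℚ) (0<u : 0ℚ ℚ.< u)
                 (π : Vec ℕ n → ℚ) (stationary : IsStationary n p q u π) where
  open GrowthRates n p u
  open Harmonic n p q u 0<u π stationary

  Edge : Vec ℕ n → Vec ℕ n → Set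
  Edge x y = Chi n p q x × Chi n p q y × y ≢ x × 0ℚ ℚ.< rate x y

  IsMax : Vec ℕ n → Set
  IsMax x = ∀ {ν} → Chi n p q ν → h ν ℚ.≤ h x

  max-spreads : ∀ {x y} → IsMax x → Edge x y → h y ≡ h x
  max-spreads {x} {y} max (chi-x , chi-y , y≢x , 0<rate) =
    sym (x∙y⁻¹≈ε⇒x≈y (h x) (h y) (pos*≡0⇒≡0 0<rate (All.lookup vanishing y∈others)))
    where
    terms-nonneg : All (λ ν → 0ℚ ℚ.≤ rate x ν * (h x - h ν)) (others x)
    terms-nonneg = All.tabulate λ ν∈ → *-nonneg (rate-nonneg (ℚP.<⇒≤ 0<u) x _) (≤⇒0≤- (max (proj₁ (∈others⇒chi ν∈))))
    vanishing : All (λ ν → rate x ν * (h x - h ν) ≡ 0ℚ) (others x)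
    vanishing = Σℚ-nonneg-≡0 (others x) _ terms-nonneg (harmonic chi-x)
    y∈others : y ∈ others x
    y∈others = ∈P.∈-filter⁺ (λ la′ → ¬? (la′ ≡? x)) (chi⇒∈chiList chi-y) y≢x

  isMax-resp : ∀ {x y} → h y ≡ h x → IsMax x → IsMax y
  isMax-resp {x} {y} hy≡hx max {ν} chi = subst (h ν ℚ.≤_) (sym hy≡hx) (max chi)

  max-along : ∀ {x y} → IsMax x → Star Edge x y → h y ≡ h x
  max-along max ε        = refl
  max-along max (e ◅ es) = trans (max-along (isMax-resp (max-spreads max e) max) es) (max-spreads max e)

  lower-edges : ∀ {v} k → Chi n p q v → 2 ≤ lookup v k → (NonIncreasing v → NonIncreasing (lower v k)) →
                Edge v (lower v k) × Edge (lower v k) v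
  lower-edges {v} k chi 2≤vk keeps =
    (chi , chi′ , lower-≢ v k 1≤vk , rate-lower-pos 0<u 1≤n v k (chi-bounded chi) 1≤vk) ,
    (chi′ , chi , lower-≢ v k 1≤vk ∘ sym , rate-raise-pos 0<u 1≤n v k (chi-bounded chi) 1≤vk)
    where
    1≤vk = ℕP.≤-trans (s≤s z≤n) 2≤vk
    chi′ = chi-lower v k chi 2≤vk keeps

  column-connected : ∀ s v → size v < s → Chi n p q v → Star Edge v (column n q) × Star Edge (column n q) v
  column-connected (suc s) v size<s chi = via (lowerable v)
    where
    via : Lowerable v → Star Edge v (column n q) × Star Edge (column n q) v
    via (flat v≤1) = subst (λ c → Star Edge v c × Star Edge c v)
                           (trans (flat⇒column v (proj₁ chi) v≤1) (cong (column n) (proj₂ (proj₂ chi)))) (ε , ε)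
    via (lowerAt k 2≤vk keeps) =
      let smaller = ℕP.<-≤-trans (size-lower v k (ℕP.≤-trans (s≤s z≤n) 2≤vk)) (ℕP.≤-pred size<s)
          down , up = column-connected s (lower v k) smaller (chi-lower v k chi 2≤vk keeps)
          edge-down , edge-up = lower-edges k chi 2≤vk keeps
      in edge-down ◅ down , up ◅◅ (edge-up ◅ ε)

  h-constant : ∀ {la mu} → Chi n p q la → Chi n p q mu → h la ≡ h mu
  h-constant {la} {mu} chi-la chi-mu = trans (h≡h[M] chi-la) (sym (h≡h[M] chi-mu))
    where
    M : Vec ℕ n
    M = argmax h la χ
    M-max : IsMax M
    M-max {ν} chi = All.lookup (f[xs]≤f[argmax] {f = h} la χ) (chi⇒∈chiList chi)
    chi-M : Chi n p q M
    chi-M = [ (λ M≡la → subst (Chi n p q) (sym M≡la) chi-la) , ∈chiList⇒chi ]′ (argmax-sel h la χ)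
    column-max : h (column n q) ≡ h M
    column-max = max-along M-max (proj₁ (column-connected (suc (size M)) M (ℕP.n<1+n (size M)) chi-M))
    h≡h[M] : ∀ {v} → Chi n p q v → h v ≡ h M
    h≡h[M] {v} chi = trans (max-along (isMax-resp column-max M-max)
                                      (proj₂ (column-connected (suc (size v)) v (ℕP.n<1+n (size v)) chi))) column-max

  π-proportional : ∀ {la mu} → Chi n p q la → Chi n p q mu → π la * weight mu ≡ π mu * weight la
  π-proportional {la} {mu} chi-la chi-mu = begin
    π la * weight mu                ≡⟨ cong (_* weight mu) (π≡h*weight la) ⟩
    h la * weight la * weight mu    ≡⟨ cong (λ x → x * weight la * weight mu) (h-constant chi-la chi-mu) ⟩
    h mu * weight la * weight mu    ≡⟨ ℚ*.xy∙z≈xz∙y (h mu) (weight la) (weight mu) ⟩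
    h mu * weight mu * weight la    ≡⟨ cong (_* weight la) (π≡h*weight mu) ⟨
    π mu * weight la                ∎
    where open ≡-Reasoning

-- The degenerate case u = 0

len≤size : ∀ {n} (v : Vec ℕ n) → len v ≤ size v
len≤size []          = z≤n
len≤size (zero ∷ v)  = len≤size v
len≤size (suc x ∷ v) = s≤s (ℕP.≤-trans (len≤size v) (ℕP.m≤n+m _ x))

0^ℚ-pos : ∀ {k} → 1 ≤ k → 0ℚ ^ℚ k ≡ 0ℚ
0^ℚ-pos {suc k} _ = ℚP.*-zeroˡ (0ℚ ^ℚ k)

weight-at-0 : ∀ n p {q} {v : Vec ℕ n} → 1 ≤ q → Chi n p q v → GrowthRates.weight n p 0ℚ v ≡ 0ℚ
weight-at-0 n p {v = v} 1≤q (_ , _ , len≡q) =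
  trans (cong (ℕtoℚ (numRearr v) *_) (0^ℚ-pos (ℕP.≤-trans 1≤q (subst (_≤ size v) len≡q (len≤size v)))))
        (ℚP.*-zeroʳ (ℕtoℚ (numRearr v)))

0≤⇒≡0⊎pos : ∀ {u} → 0ℚ ℚ.≤ u → u ≡ 0ℚ ⊎ 0ℚ ℚ.< u
0≤⇒≡0⊎pos {u} 0≤u with u ℚP.≤? 0ℚ
... | yes u≤0 = inj₁ (ℚP.≤-antisym u≤0 0≤u)
... | no u≰0  = inj₂ (ℚP.≰⇒> u≰0)

stationary-proportional : ∀ n p q → 1 ≤ q → q < n → ∀ u → 0ℚ ℚ.≤ u → ∀ π → IsStationary n p q u π →
                          ∀ {la mu} → Chi n p q la → Chi n p q mu →
                          π la * GrowthRates.weight n p u mu ≡ π mu * GrowthRates.weight n p u la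
stationary-proportional n p q 1≤q q<n u 0≤u π stationary {la} {mu} chi-la chi-mu = [ at-0 , positive ]′ (0≤⇒≡0⊎pos 0≤u)
  where
  weight : ℚ → Vec ℕ n → ℚ
  weight u = GrowthRates.weight n p u
  at-0 : u ≡ 0ℚ → π la * weight u mu ≡ π mu * weight u la
  at-0 u≡0 = subst (λ u → π la * weight u mu ≡ π mu * weight u la) (sym u≡0) (begin
    π la * weight 0ℚ mu   ≡⟨ cong (π la *_) (weight-at-0 n p 1≤q chi-mu) ⟩
    π la * 0ℚ             ≡⟨ ℚP.*-zeroʳ (π la) ⟩
    0ℚ                    ≡⟨ ℚP.*-zeroʳ (π mu) ⟨
    π mu * 0ℚ             ≡⟨ cong (π mu *_) (weight-at-0 n p 1≤q chi-la) ⟨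
    π mu * weight 0ℚ la   ∎)
    where open ≡-Reasoning
  positive : 0ℚ ℚ.< u → π la * weight u mu ≡ π mu * weight u la
  positive 0<u = Constancy.π-proportional n p q (ℕP.≤-trans 1≤q (ℕP.<⇒≤ q<n)) u 0<u π stationary chi-la chi-mu

theorem3p6 : (n p q : ℕ) → 1 ≤ p → 1 ≤ q → q < n →
    (u : ℚ) → 0ℚ Data.Rational.≤ u → u Data.Rational.≤ 1ℚ →
    (π : Vec ℕ n → ℚ) → IsStationary n p q u π →
    (la mu : Vec ℕ n) → Chi n p q la → Chi n p q mu →
    π la * ℕtoℚ (numRearr mu) * (u ^ℚ size mu)
      ≡ π mu * ℕtoℚ (numRearr la) * (u ^ℚ size la)
theorem3p6 n p q _ 1≤q q<n u 0≤u _ π stationary la mu chi-la chi-mu = begin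
  π la * ℕtoℚ (numRearr mu) * (u ^ℚ size mu)    ≡⟨ ℚP.*-assoc (π la) (ℕtoℚ (numRearr mu)) (u ^ℚ size mu) ⟩
  π la * weight mu                               ≡⟨ stationary-proportional n p q 1≤q q<n u 0≤u π stationary chi-la chi-mu ⟩
  π mu * weight la                               ≡⟨ ℚP.*-assoc (π mu) (ℕtoℚ (numRearr la)) (u ^ℚ size la) ⟨
  π mu * ℕtoℚ (numRearr la) * (u ^ℚ size la)    ∎
  where
  open ≡-Reasoning
  open GrowthRates n p u using (weight)
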